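{- Let $G$ be a finite group and $N$ a nontrivial, proper, normal subgroup of $G$ such that $N$ and $G/N$ each admit a DRR (respectively, a GRR). Suppose (1) $Z(N) \le Z(G)$, and (2) the order of the abelianization of $G/N$ is relatively prime to $|Z(N)|$. Then $G$ is not DRR-detecting (respectively, not GRR-detecting). More precisely, if $\Gamma_1 = \mathrm{Cay}(G/N, \overline{S_1})$ is a loopless DRR (respectively, GRR) of $G/N$ and $\Gamma_2 = \mathrm{Cay}(N,S_2)$ is a loopless DRR (respectively, GRR) of $N$, and $S_1 = \{g \in G : gN \in \overline{S_1}\}$, then the Cayley digraph $\mathrm{Cay}(G, S_1 \cup S_2)$, which is isomorphic to the wreath product $\Gamma_1 \wr \Gamma_2$, witnesses that $G$ is not DRR-detecting (respectively, not GRR-detecting).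
   Context: All groups and graphs are finite. For a subset $S$ of a group $G$, the Cayley digraph $\mathrm{Cay}(G,S)$ has vertex set $G$ and a directed edge from $g_1$ to $g_2$ iff $g_2 = s g_1$ for some $s \in S$; if $S$ is inverse-closed it is a graph (Cayley graph). $\mathrm{Aut}(G,S) = \{\varphi \in \mathrm{Aut}(G) : \varphi(S) = S\}$. A digraph $\Gamma$ is a DRR of $G$ if $\mathrm{Aut}(\Gamma) \cong G$ and acts regularly on the vertices; a GRR is a DRR that is a graph. $G$ is GRR-detecting if for every inverse-closed $S \subseteq G$, $\mathrm{Aut}(G,S)=\{1\}$ implies $\mathrm{Cay}(G,S)$ is a GRR; $G$ is DRR-detecting if for every $S \subseteq G$, $\mathrm{Aut}(G,S)=\{1\}$ implies $\mathrm{Cay}(G,S)$ is a DRR. A Cayley (di)graph $\mathrm{Cay}(G,S)$ witnesses that $G$ is not DRR-detecting (not GRR-detecting) if $\mathrm{Aut}(G,S)=\{1\}$ but it is not a DRR (not a GRR). The wreath product $X \wr Y$ of digraphs has vertex set $V(X)\times V(Y)$, with an edge from $(x_1,y_1)$ to $(x_2,y_2)$ iff either there is an edge from $x_1$ to $x_2$ in $X$, or $x_1=x_2$ and there is an edge from $y_1$ to $y_2$ in $Y$. $Z(\cdot)$ denotes the center. -}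

module Defs where

open import Level using (0ℓ)
open import Data.Nat using (ℕ)
open import Data.Nat.Coprimality using (Coprime)
open import Data.Fin using (Fin)
open import Data.Bool using (Bool)
open import Data.List using (List; foldr)
open import Data.List.Relation.Unary.All using (All)
open import Data.Product using (Σ; ∃; _×_; _,_)
open import Data.Sum using (_⊎_)
open import Relation.Nullary using (¬_)
open import Relation.Binary.PropositionalEquality using (_≡_; _≢_)
open import Algebra.Structures using (IsGroup)
open import Function.Definitions using (Injective)

record FinGroup : Set where
  infixl 7 _∙_
  field
    order   : ℕ
    _∙_     : Fin order → Fin order → Fin order
    ε       : Fin order
    _⁻¹     : Fin order → Fin order
    isGroup : IsGroup _≡_ _∙_ ε _⁻¹

  Elt : Set
  Elt = Fin order

open FinGroup public using (Elt; order)

Subset : FinGroup → Set₁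
Subset G = Elt G → Set

module _ (G : FinGroup) where
  open FinGroup G hiding (Elt; order)

  Central : Elt G → Set
  Central z = ∀ g → z ∙ g ≡ g ∙ z

  InverseClosed : Subset G → Set
  InverseClosed S = ∀ x → S x → S (x ⁻¹)

  Generated : Subset G → Subset G
  Generated P x = Σ (List (Elt G)) λ ws →
    All (λ w → P w ⊎ P (w ⁻¹)) ws × (x ≡ foldr _∙_ ε ws)

  IsCommutator : Subset G
  IsCommutator x = Σ (Elt G) λ a → Σ (Elt G) λ b → x ≡ a ⁻¹ ∙ b ⁻¹ ∙ a ∙ b

  Derived : Subset G
  Derived = Generated IsCommutator

  record GroupAut : Set where
    field
      fun     : Elt G → Elt G
      invFun  : Elt G → Elt G
      hom     : ∀ x y → fun (x ∙ y) ≡ fun x ∙ fun y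
      leftInv : ∀ x → invFun (fun x) ≡ x
      rightInv : ∀ x → fun (invFun x) ≡ x

  TrivialAutGS : Subset G → Set
  TrivialAutGS S = (φ : GroupAut) →
    (∀ x → (S x → S (GroupAut.fun φ x)) × (S (GroupAut.fun φ x) → S x)) →
    ∀ x → GroupAut.fun φ x ≡ x

HasSize : {n : ℕ} → (Fin n → Set) → ℕ → Set
HasSize {n} P k = Σ (Fin k → Fin n) λ f →
  Injective _≡_ _≡_ f × (∀ i → P (f i)) × (∀ x → P x → ∃ λ i → f i ≡ x)

record Digraph : Set₁ where
  field
    V : Set
    E : V → V → Set

open Digraph public

record DigraphIso (Γ Δ : Digraph) : Set where
  field
    fun      : V Γ → V Δ
    invFun   : V Δ → V Γ
    leftInv  : ∀ x → invFun (fun x) ≡ x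
    rightInv : ∀ y → fun (invFun y) ≡ y
    edge     : ∀ u v → (E Γ u v → E Δ (fun u) (fun v)) × (E Δ (fun u) (fun v) → E Γ u v)

DigraphAut : Digraph → Set
DigraphAut Γ = DigraphIso Γ Γ

RegularAut : Digraph → Set
RegularAut Γ = ∀ u v →
  (Σ (DigraphAut Γ) λ φ → DigraphIso.fun φ u ≡ v) ×
  (∀ (φ ψ : DigraphAut Γ) → DigraphIso.fun φ u ≡ v → DigraphIso.fun ψ u ≡ v →
     ∀ x → DigraphIso.fun φ x ≡ DigraphIso.fun ψ x)

Wreath : Digraph → Digraph → Digraph
Wreath X Y = record
  { V = V X × V Y
  ; E = λ { (x₁ , y₁) (x₂ , y₂) → E X x₁ x₂ ⊎ (x₁ ≡ x₂ × E Y y₁ y₂) } }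

module _ (G : FinGroup) where
  open FinGroup G hiding (Elt; order)

  Cay : Subset G → Digraph
  Cay S = record { V = Elt G ; E = λ g₁ g₂ → Σ (Elt G) λ s → S s × (g₂ ≡ s ∙ g₁) }

  Loopless : Subset G → Set
  Loopless S = ¬ S ε

  -- Cay(G,S) is a DRR: its automorphism group acts regularly
  -- (it then equals the right regular representation, so is ≅ G)
  IsDRR : Subset G → Set
  IsDRR S = RegularAut (Cay S)

  -- a GRR is a DRR that is a graph (S inverse-closed)
  IsGRR : Subset G → Set
  IsGRR S = InverseClosed G S × IsDRR S

  AdmitsDRR : Set₁
  AdmitsDRR = Σ (Subset G) IsDRR

  AdmitsGRR : Set₁
  AdmitsGRR = Σ (Subset G) IsGRR

  DRRDetecting : Set₁
  DRRDetecting = (S : Subset G) → TrivialAutGS G S → IsDRR S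

  GRRDetecting : Set₁
  GRRDetecting = (S : Subset G) → InverseClosed G S → TrivialAutGS G S → IsGRR S

  WitnessNotDRRDetecting : Subset G → Set
  WitnessNotDRRDetecting S = TrivialAutGS G S × ¬ IsDRR S

  WitnessNotGRRDetecting : Subset G → Set
  WitnessNotGRRDetecting S = InverseClosed G S × TrivialAutGS G S × ¬ IsGRR S

-- Setting of Corollary 4.11: N ⊴ G presented by an injective hom
-- ι : H → G with image N, and G/N presented by a surjective hom
-- π : G → Q with kernel exactly N.

IsHom : (A B : FinGroup) → (Elt A → Elt B) → Set
IsHom A B f = ∀ x y → f (FinGroup._∙_ A x y) ≡ FinGroup._∙_ B (f x) (f y)

LiftUnion : (G H Q : FinGroup) (ι : Elt H → Elt G) (π : Elt G → Elt Q) →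
            Subset Q → Subset H → Subset G
LiftUnion G H Q ι π S̄₁ S₂ x = S̄₁ (π x) ⊎ (Σ (Elt H) λ h → ι h ≡ x × S₂ h)

module Submission where

-- N ⊴ G is the image of an injective homomorphism ι : H → G, and G/N is
-- presented by a surjective π : G → Q with kernel N.  For DRRs Cay(Q,S̄₁)
-- and Cay(H,S₂) put S = π⁻¹(S̄₁) ∪ ι(S₂).  Then
--  * g ↦ (π g, position of g in its coset) is an isomorphism
--    Cay(G,S) ≅ Cay(Q,S̄₁) ≀ Cay(H,S₂);
--  * S ∖ N is a union of cosets of N, so N can be shifted on its own and
--    Cay(G,S) is not a DRR (`absorbing-trivial`);
--  * Aut(G,S) = 1: an automorphism φ preserving S maps N into N, since
--    otherwise φ(N) is an absorbing subgroup that is either killed by π or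
--    a complement of N, forcing |Q| = |H| = 2 against coprimality; so φ
--    restricts to H and induces on Q automorphisms preserving S₂ and S̄₁,
--    which are trivial, and the core lemma `central-automorphism-trivial`
--    (a transfer argument over coset representatives plus Bézout) gives φ = 1.
-- The file develops group and Cayley-digraph basics, the two obstructions
-- to being a DRR, finite counting (Lagrange, the transfer lemma in the
-- centre), then the extension setting; the corollary is derived last,
-- removing ε from connection sets to pass from DRRs to loopless ones.

open import Defs
open import Level using (0ℓ)
open import Algebra.Bundles using (Group; CommutativeMonoid)
open import Algebra.Structures using (IsGroup)
import Algebra.Properties.Group as GroupProperties
open import Data.Fin as Fin using (Fin; punchOut; toℕ; remQuot; combine)
open import Data.Fin.Properties using (_≟_; any?; all?; ¬∀⟶∃¬; toℕ-injective; remQuot-combine; combine-remQuot; injective⇒≤; punchOut-injective; suc-injective; ¬Fin0)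
open import Data.Product using (Σ; ∃; _×_; _,_; proj₁; proj₂)
open import Relation.Nullary using (¬_; Dec; yes; no; _×-dec_)
open import Relation.Binary.PropositionalEquality
open import Data.Empty using (⊥-elim)
open import Data.Unit using (⊤; tt)
open import Data.Nat using (ℕ; zero; suc; _+_; _*_; _≤_; _≤?_)
open import Data.Nat.Coprimality using (Coprime; coprime-Bézout)
open import Data.Nat.GCD using (module Bézout)
open import Data.Nat.Divisibility using (∣-refl)
open import Data.Nat.Properties using (*-comm; *-cancelʳ-≡; *-identityˡ; ≤-antisym; ≤-refl; ≤-trans; ≰⇒≥; n≮n)
open import Data.Sum using (_⊎_; inj₁; inj₂)
open import Data.List using ([]; _∷_; foldr; _++_)
open import Data.List.Relation.Unary.All using (All; []; _∷_)
open import Data.List.Relation.Unary.All.Properties using (++⁺)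
open import Function.Definitions using (Injective)
open import Relation.Nullary.Decidable using (dec-true; dec-false)
open import Data.Fin.Permutation using (Permutation; permutation)
open import Data.Fin.Permutation.Components using (transpose; transpose-inverse)

_⇔_ : Set → Set → Set
A ⇔ B = (A → B) × (B → A)

⇔-refl : {A : Set} → A ⇔ A
⇔-refl = (λ a → a) , (λ a → a)

⇔-trans : {A B C : Set} → A ⇔ B → B ⇔ C → A ⇔ C
⇔-trans (f , f⁻¹) (g , g⁻¹) = (λ a → g (f a)) , (λ c → f⁻¹ (g⁻¹ c))

subst-⇔ : {A : Set} (T : A → Set) {x y : A} → x ≡ y → T x ⇔ T y
subst-⇔ T refl = ⇔-refl

module GroupKit (K : FinGroup) where
  open FinGroup K public using (_∙_; ε; _⁻¹)
  open IsGroup (FinGroup.isGroup K) public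
    using (assoc; identityˡ; identityʳ; inverseˡ; inverseʳ)

  private
    group : Group 0ℓ 0ℓ
    group = record { isGroup = FinGroup.isGroup K }

  open GroupProperties group public
    using (⁻¹-involutive; ⁻¹-anti-homo-∙; ε⁻¹≈ε; ⁻¹-injective;
           ∙-cancelˡ; ∙-cancelʳ; inverseˡ-unique; inverseʳ-unique; x∙y⁻¹≈ε⇒x≈y)
    renaming (\\-leftDividesʳ to x⁻¹∙[x∙y]≡y; \\-leftDividesˡ to x∙[x⁻¹∙y]≡y;
              //-rightDividesʳ to [y∙x]∙x⁻¹≡y; //-rightDividesˡ to [y∙x⁻¹]∙x≡y;
              x≈z//y to moveʳ; y≈x\\z to moveˡ)

  distinct⇒quotient≢ε : ∀ {u v} → u ≢ v → v ∙ u ⁻¹ ≢ ε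
  distinct⇒quotient≢ε u≢v e = u≢v (sym (x∙y⁻¹≈ε⇒x≈y _ _ e))

  [x∙z]∙[y∙z]⁻¹≡x∙y⁻¹ : ∀ x y z → x ∙ z ∙ (y ∙ z) ⁻¹ ≡ x ∙ y ⁻¹
  [x∙z]∙[y∙z]⁻¹≡x∙y⁻¹ x y z = begin
    x ∙ z ∙ (y ∙ z) ⁻¹     ≡⟨ cong (x ∙ z ∙_) (⁻¹-anti-homo-∙ y z) ⟩
    x ∙ z ∙ (z ⁻¹ ∙ y ⁻¹)  ≡⟨ sym (assoc _ _ _) ⟩
    x ∙ z ∙ z ⁻¹ ∙ y ⁻¹    ≡⟨ cong (_∙ y ⁻¹) ([y∙x]∙x⁻¹≡y z x) ⟩
    x ∙ y ⁻¹               ∎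
    where open ≡-Reasoning

  conjugate-∙ : ∀ x y k → x ∙ y ∙ k ∙ (x ∙ y) ⁻¹ ≡ x ∙ (y ∙ k ∙ y ⁻¹) ∙ x ⁻¹
  conjugate-∙ x y k = begin
    x ∙ y ∙ k ∙ (x ∙ y) ⁻¹         ≡⟨ cong₂ _∙_ (assoc x y k) (⁻¹-anti-homo-∙ x y) ⟩
    x ∙ (y ∙ k) ∙ (y ⁻¹ ∙ x ⁻¹)    ≡⟨ sym (assoc _ _ _) ⟩
    x ∙ (y ∙ k) ∙ y ⁻¹ ∙ x ⁻¹      ≡⟨ cong (_∙ x ⁻¹) (assoc _ _ _) ⟩
    x ∙ (y ∙ k ∙ y ⁻¹) ∙ x ⁻¹      ∎
    where open ≡-Reasoning

  [x∙y]⁻¹∙[x∙y']≡y⁻¹∙y' : ∀ x y y' → (x ∙ y) ⁻¹ ∙ (x ∙ y') ≡ y ⁻¹ ∙ y'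
  [x∙y]⁻¹∙[x∙y']≡y⁻¹∙y' x y y' = begin
    (x ∙ y) ⁻¹ ∙ (x ∙ y')        ≡⟨ cong (_∙ (x ∙ y')) (⁻¹-anti-homo-∙ x y) ⟩
    y ⁻¹ ∙ x ⁻¹ ∙ (x ∙ y')       ≡⟨ assoc _ _ _ ⟩
    y ⁻¹ ∙ (x ⁻¹ ∙ (x ∙ y'))     ≡⟨ cong (y ⁻¹ ∙_) (x⁻¹∙[x∙y]≡y x y') ⟩
    y ⁻¹ ∙ y'                    ∎
    where open ≡-Reasoning

module HomKit (A B : FinGroup) (f : Elt A → Elt B) (hom : IsHom A B f) where
  private
    module A = GroupKit A
    module B = GroupKit B

  hom-ε : f A.ε ≡ B.ε
  hom-ε = B.∙-cancelˡ (f A.ε) (f A.ε) B.ε (begin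
    f A.ε B.∙ f A.ε     ≡⟨ sym (hom A.ε A.ε) ⟩
    f (A.ε A.∙ A.ε)     ≡⟨ cong f (A.identityˡ A.ε) ⟩
    f A.ε               ≡⟨ sym (B.identityʳ (f A.ε)) ⟩
    f A.ε B.∙ B.ε       ∎)
    where open ≡-Reasoning

  hom-⁻¹ : ∀ x → f (x A.⁻¹) ≡ f x B.⁻¹
  hom-⁻¹ x = B.inverseʳ-unique (f x) (f (x A.⁻¹))
    (trans (sym (hom x (x A.⁻¹))) (trans (cong f (A.inverseʳ x)) hom-ε))

  hom-quotient : ∀ x y → f (x A.∙ y A.⁻¹) ≡ f x B.∙ f y B.⁻¹
  hom-quotient x y = trans (hom x (y A.⁻¹)) (cong (f x B.∙_) (hom-⁻¹ y))

inverseAut : {K : FinGroup} → GroupAut K → GroupAut K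
inverseAut {K} φ = record
  { fun = invFun ; invFun = fun ; hom = invFun-hom ; leftInv = rightInv ; rightInv = leftInv }
  where
  open GroupAut φ
  open GroupKit K
  invFun-hom : ∀ x y → invFun (x ∙ y) ≡ invFun x ∙ invFun y
  invFun-hom x y = begin
    invFun (x ∙ y)                             ≡⟨ cong invFun (cong₂ _∙_ (sym (rightInv x)) (sym (rightInv y))) ⟩
    invFun (fun (invFun x) ∙ fun (invFun y))   ≡⟨ cong invFun (sym (hom (invFun x) (invFun y))) ⟩
    invFun (fun (invFun x ∙ invFun y))         ≡⟨ leftInv _ ⟩
    invFun x ∙ invFun y                        ∎
    where open ≡-Reasoning

-- Cayley digraphs: an edge u → v of Cay(K,T) is exactly the statement
-- v u⁻¹ ∈ T, so a permutation of K is a digraph automorphism as soon as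
-- it respects membership of such quotients in T.
module CayleyKit (K : FinGroup) where
  open GroupKit K

  RespectsQuotients : Subset K → (Elt K → Elt K) → Set
  RespectsQuotients T f = ∀ u v → T (v ∙ u ⁻¹) ⇔ T (f v ∙ f u ⁻¹)

  edge⇒quotient : (T : Subset K) → ∀ u v → E (Cay K T) u v → T (v ∙ u ⁻¹)
  edge⇒quotient T u v (s , s∈T , refl) = subst T (sym ([y∙x]∙x⁻¹≡y u s)) s∈T

  quotient⇒edge : (T : Subset K) → ∀ u v → T (v ∙ u ⁻¹) → E (Cay K T) u v
  quotient⇒edge T u v t = v ∙ u ⁻¹ , t , sym ([y∙x⁻¹]∙x≡y u v)

  cayleyAut : (T : Subset K) (f g : Elt K → Elt K) →
              (∀ x → g (f x) ≡ x) → (∀ x → f (g x) ≡ x) →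
              RespectsQuotients T f → DigraphAut (Cay K T)
  cayleyAut T f g gf fg respects = record
    { fun = f ; invFun = g ; leftInv = gf ; rightInv = fg
    ; edge = λ u v →
        (λ e → quotient⇒edge T (f u) (f v) (proj₁ (respects u v) (edge⇒quotient T u v e)))
      , (λ e → quotient⇒edge T u v (proj₂ (respects u v) (edge⇒quotient T (f u) (f v) e))) }

  autRespects : (T : Subset K) (α : DigraphAut (Cay K T)) → RespectsQuotients T (DigraphIso.fun α)
  autRespects T α u v =
      (λ t → edge⇒quotient T _ _ (proj₁ (DigraphIso.edge α u v) (quotient⇒edge T u v t)))
    , (λ t → edge⇒quotient T u v (proj₂ (DigraphIso.edge α u v) (quotient⇒edge T _ _ t)))

  identityAut : (T : Subset K) → DigraphAut (Cay K T)
  identityAut T = cayleyAut T (λ x → x) (λ x → x) (λ _ → refl) (λ _ → refl) (λ _ _ → ⇔-refl)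

  drr-rigid : (T : Subset K) → IsDRR K T → (α : DigraphAut (Cay K T)) →
              ∀ c → DigraphIso.fun α c ≡ c → ∀ x → DigraphIso.fun α x ≡ x
  drr-rigid T drr α c fixed = proj₂ (drr c c) α (identityAut T) fixed refl

  -- Aut(K,T) consists of digraph automorphisms fixing ε, hence is
  -- trivial for a DRR
  drr⇒trivialAutGS : (T : Subset K) → IsDRR K T → TrivialAutGS K T
  drr⇒trivialAutGS T drr φ preserves =
    drr-rigid T drr (cayleyAut T fun invFun leftInv rightInv respects) ε hom-ε
    where
    open GroupAut φ
    open HomKit K K fun hom using (hom-ε; hom-quotient)
    respects : RespectsQuotients T fun
    respects u v = (λ t → subst T (hom-quotient v u) (proj₁ (preserves _) t))
                 , (λ t → proj₂ (preserves _) (subst T (sym (hom-quotient v u)) t))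

-- Removing ε from T loses only loops: it changes neither the
-- automorphisms of Cay(K,T) nor inverse-closedness.
module WithoutIdentity (K : FinGroup) (T : Subset K) where
  open GroupKit K
  open CayleyKit K

  T° : Subset K
  T° x = T x × x ≢ ε

  T°-loopless : Loopless K T°
  T°-loopless (_ , ε≢ε) = ε≢ε refl

  T°-inverseClosed : InverseClosed K T → InverseClosed K T°
  T°-inverseClosed closed x (t , x≢ε) = closed x t , λ e → x≢ε (⁻¹-injective (trans e (sym ε⁻¹≈ε)))

  respects-T° : (f : Elt K → Elt K) → Injective _≡_ _≡_ f → RespectsQuotients T f ⇔ RespectsQuotients T° f
  respects-T° f f-injective = to , from
    where
    image-quotient≢ε : ∀ {u v} → u ≢ v → f v ∙ f u ⁻¹ ≢ ε
    image-quotient≢ε u≢v = distinct⇒quotient≢ε (λ e → u≢v (f-injective e))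
    to : RespectsQuotients T f → RespectsQuotients T° f
    to respects u v =
        (λ { (t , q≢ε) → proj₁ (respects u v) t , image-quotient≢ε (λ { refl → q≢ε (inverseʳ u) }) })
      , (λ { (t , q≢ε) → proj₂ (respects u v) t , distinct⇒quotient≢ε (λ { refl → q≢ε (inverseʳ (f u)) }) })
    from : RespectsQuotients T° f → RespectsQuotients T f
    from respects u v with u ≟ v
    ... | yes refl = subst-⇔ T (trans (inverseʳ u) (sym (inverseʳ (f u))))
    ... | no u≢v = (λ t → proj₁ (proj₁ (respects u v) (t , distinct⇒quotient≢ε u≢v)))
                 , (λ t → proj₁ (proj₂ (respects u v) (t , image-quotient≢ε u≢v)))

  carry : {U U' : Subset K} → (∀ f → Injective _≡_ _≡_ f → RespectsQuotients U f → RespectsQuotients U' f) →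
          DigraphAut (Cay K U) → DigraphAut (Cay K U')
  carry {U} convert α = cayleyAut _ (fun α) (invFun α) (leftInv α) (rightInv α)
                          (convert (fun α) injective (autRespects U α))
    where
    open DigraphIso
    injective : Injective _≡_ _≡_ (fun α)
    injective {x} {y} e = trans (sym (leftInv α x)) (trans (cong (invFun α) e) (leftInv α y))

  drr-T° : IsDRR K T → IsDRR K T°
  drr-T° drr u v =
      (carry toT° (proj₁ (proj₁ (drr u v))) , proj₂ (proj₁ (drr u v)))
    , (λ α β αu≡v βu≡v → proj₂ (drr u v) (carry fromT° α) (carry fromT° β) αu≡v βu≡v)
    where
    toT° : ∀ f → Injective _≡_ _≡_ f → RespectsQuotients T f → RespectsQuotients T° f
    toT° f f-injective = proj₁ (respects-T° f f-injective)
    fromT° : ∀ f → Injective _≡_ _≡_ f → RespectsQuotients T° f → RespectsQuotients T f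
    fromT° f f-injective = proj₂ (respects-T° f f-injective)

module _ (K : FinGroup) where
  open GroupKit K

  -- A decidable subgroup D of K such that T ∖ D is a union of double
  -- cosets DxD.  Cay(K,T) then looks the same inside every coset of D,
  -- which lets D be moved around independently of the rest.
  record Absorbing (T : Subset K) : Set₁ where
    field
      D       : Subset K
      D?      : ∀ x → Dec (D x)
      D-∙     : ∀ x y → D x → D y → D (x ∙ y)
      D-⁻¹    : ∀ x → D x → D (x ⁻¹)
      absorbʳ : ∀ x d → ¬ D x → D d → T x → T (x ∙ d)
      absorbˡ : ∀ x d → ¬ D x → D d → T x → T (d ∙ x)

  -- T is all-or-nothing on K ∖ {ε}: Cay(K,T) is complete or has no
  -- edges between distinct vertices
  AllOrNothing : Subset K → Set
  AllOrNothing T = ∀ p p' → p ≢ ε → p' ≢ ε → T p → T p'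

module Obstructions (K : FinGroup) where
  open GroupKit K
  open CayleyKit K

  module AbsorbingShift {T : Subset K} (A : Absorbing K T) where
    open Absorbing A

    D-ε : ∀ m → D m → D ε
    D-ε m m∈D = subst D (inverseʳ m) (D-∙ _ _ m∈D (D-⁻¹ m m∈D))

    outsideʳ : ∀ x d → ¬ D x → D d → ¬ D (x ∙ d)
    outsideʳ x d x∉D d∈D xd∈D = x∉D (subst D ([y∙x]∙x⁻¹≡y d x) (D-∙ _ _ xd∈D (D-⁻¹ d d∈D)))

    outsideˡ : ∀ x d → ¬ D x → D d → ¬ D (d ∙ x)
    outsideˡ x d x∉D d∈D dx∈D = x∉D (subst D (x⁻¹∙[x∙y]≡y d x) (D-∙ _ _ (D-⁻¹ d d∈D) dx∈D))

    absorbʳ-⇔ : ∀ x d → ¬ D x → D d → T x ⇔ T (x ∙ d)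
    absorbʳ-⇔ x d x∉D d∈D = absorbʳ x d x∉D d∈D
      , λ t → subst T ([y∙x]∙x⁻¹≡y d x) (absorbʳ _ _ (outsideʳ x d x∉D d∈D) (D-⁻¹ d d∈D) t)

    absorbˡ-⇔ : ∀ x d → ¬ D x → D d → T x ⇔ T (d ∙ x)
    absorbˡ-⇔ x d x∉D d∈D = absorbˡ x d x∉D d∈D
      , λ t → subst T (x⁻¹∙[x∙y]≡y d x) (absorbˡ _ _ (outsideˡ x d x∉D d∈D) (D-⁻¹ d d∈D) t)

    shift : Elt K → Elt K → Elt K
    shift k x with D? x
    ... | yes _ = x ∙ k
    ... | no _  = x

    shift-in : ∀ k {x} → D x → shift k x ≡ x ∙ k
    shift-in k {x} x∈D with D? x
    ... | yes _   = refl
    ... | no x∉D  = ⊥-elim (x∉D x∈D)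

    shift-out : ∀ k {x} → ¬ D x → shift k x ≡ x
    shift-out k {x} x∉D with D? x
    ... | yes x∈D = ⊥-elim (x∉D x∈D)
    ... | no _    = refl

    shift-inverse : ∀ k → D k → ∀ x → shift (k ⁻¹) (shift k x) ≡ x
    shift-inverse k k∈D x with D? x
    ... | yes x∈D = trans (shift-in (k ⁻¹) (D-∙ x k x∈D k∈D)) ([y∙x]∙x⁻¹≡y k x)
    ... | no x∉D  = shift-out (k ⁻¹) x∉D

    shift-inverse′ : ∀ k → D k → ∀ x → shift k (shift (k ⁻¹) x) ≡ x
    shift-inverse′ k k∈D x =
      subst (λ k′ → shift k′ (shift (k ⁻¹) x) ≡ x) (⁻¹-involutive k)
            (shift-inverse (k ⁻¹) (D-⁻¹ k k∈D) x)

    ⁻¹-outside : ∀ {x} → ¬ D x → ¬ D (x ⁻¹)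
    ⁻¹-outside {x} x∉D x⁻¹∈D = x∉D (subst D (⁻¹-involutive x) (D-⁻¹ _ x⁻¹∈D))

    -- an edge leaving D: v u⁻¹ ↦ v (u k)⁻¹ = (v u⁻¹)(u k⁻¹ u⁻¹)
    respects-leaving : ∀ k → D k → ∀ {u v} → D u → ¬ D v → T (v ∙ u ⁻¹) ⇔ T (v ∙ (u ∙ k) ⁻¹)
    respects-leaving k k∈D {u} {v} u∈D v∉D =
      ⇔-trans (absorbʳ-⇔ (v ∙ u ⁻¹) _ (outsideʳ v (u ⁻¹) v∉D (D-⁻¹ u u∈D)) conjugate∈D) (subst-⇔ T moved)
      where
      conjugate∈D : D (u ∙ k ⁻¹ ∙ u ⁻¹)
      conjugate∈D = D-∙ _ _ (D-∙ _ _ u∈D (D-⁻¹ k k∈D)) (D-⁻¹ u u∈D)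
      moved : v ∙ u ⁻¹ ∙ (u ∙ k ⁻¹ ∙ u ⁻¹) ≡ v ∙ (u ∙ k) ⁻¹
      moved = begin
        v ∙ u ⁻¹ ∙ (u ∙ k ⁻¹ ∙ u ⁻¹)  ≡⟨ sym (assoc _ _ _) ⟩
        v ∙ u ⁻¹ ∙ (u ∙ k ⁻¹) ∙ u ⁻¹  ≡⟨ cong (_∙ u ⁻¹) (sym (assoc _ _ _)) ⟩
        v ∙ u ⁻¹ ∙ u ∙ k ⁻¹ ∙ u ⁻¹    ≡⟨ cong (λ w → w ∙ k ⁻¹ ∙ u ⁻¹) ([y∙x⁻¹]∙x≡y u v) ⟩
        v ∙ k ⁻¹ ∙ u ⁻¹               ≡⟨ assoc _ _ _ ⟩
        v ∙ (k ⁻¹ ∙ u ⁻¹)             ≡⟨ cong (v ∙_) (sym (⁻¹-anti-homo-∙ u k)) ⟩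
        v ∙ (u ∙ k) ⁻¹                ∎
        where open ≡-Reasoning

    -- an edge entering D: v u⁻¹ ↦ v k u⁻¹ = (v k v⁻¹)(v u⁻¹)
    respects-entering : ∀ k → D k → ∀ {u v} → ¬ D u → D v → T (v ∙ u ⁻¹) ⇔ T (v ∙ k ∙ u ⁻¹)
    respects-entering k k∈D {u} {v} u∉D v∈D =
      ⇔-trans (absorbˡ-⇔ (v ∙ u ⁻¹) _ (outsideˡ (u ⁻¹) v (⁻¹-outside u∉D) v∈D) conjugate∈D) (subst-⇔ T moved)
      where
      conjugate∈D : D (v ∙ k ∙ v ⁻¹)
      conjugate∈D = D-∙ _ _ (D-∙ _ _ v∈D k∈D) (D-⁻¹ v v∈D)
      moved : v ∙ k ∙ v ⁻¹ ∙ (v ∙ u ⁻¹) ≡ v ∙ k ∙ u ⁻¹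
      moved = trans (assoc _ _ _) (cong (v ∙ k ∙_) (x⁻¹∙[x∙y]≡y v (u ⁻¹)))

    shift-respects : ∀ k → D k → RespectsQuotients T (shift k)
    shift-respects k k∈D u v with D? u | D? v
    ... | yes u∈D | yes v∈D = subst-⇔ T (sym ([x∙z]∙[y∙z]⁻¹≡x∙y⁻¹ v u k))
    ... | yes u∈D | no v∉D  = respects-leaving k k∈D u∈D v∉D
    ... | no u∉D  | yes v∈D = respects-entering k k∈D u∉D v∈D
    ... | no _    | no _    = ⇔-refl

    -- Lemma: in a DRR, a proper absorbing subgroup is trivial (the shift
    -- of D alone would be an automorphism with a fixed point outside D).
    absorbing-trivial : IsDRR K T → (∃ λ c → ¬ D c) → ∀ m → D m → m ≡ ε
    absorbing-trivial drr (c , c∉D) m m∈D = begin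
      m          ≡⟨ sym (identityˡ m) ⟩
      ε ∙ m      ≡⟨ sym (shift-in m (D-ε m m∈D)) ⟩
      shift m ε  ≡⟨ drr-rigid T drr shiftAut c (shift-out m c∉D) ε ⟩
      ε          ∎
      where
      open ≡-Reasoning
      shiftAut : DigraphAut (Cay K T)
      shiftAut = cayleyAut T (shift m) (shift (m ⁻¹))
        (shift-inverse m m∈D) (shift-inverse′ m m∈D) (shift-respects m m∈D)

  open AbsorbingShift public using (absorbing-trivial)

  transport-absorbing : {T : Subset K} (φ : GroupAut K) → (∀ x → T x ⇔ T (GroupAut.fun φ x)) →
                        Absorbing K T → Absorbing K T
  transport-absorbing {T} φ preserves A = record
    { D = λ x → D (φ⁻¹ x)
    ; D? = λ x → D? (φ⁻¹ x)
    ; D-∙ = λ x y Dx Dy → subst D (sym (φ⁻¹-hom x y)) (D-∙ _ _ Dx Dy)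
    ; D-⁻¹ = λ x Dx → subst D (sym (φ⁻¹-⁻¹ x)) (D-⁻¹ _ Dx)
    ; absorbʳ = λ x d x∉D d∈D t → pulled-back (φ⁻¹-hom x d) (absorbʳ _ _ x∉D d∈D (pull t))
    ; absorbˡ = λ x d x∉D d∈D t → pulled-back (φ⁻¹-hom d x) (absorbˡ _ _ x∉D d∈D (pull t)) }
    where
    open Absorbing A
    open GroupAut (inverseAut φ) using () renaming (fun to φ⁻¹; hom to φ⁻¹-hom)
    open GroupAut φ using () renaming (rightInv to φφ⁻¹)
    open HomKit K K φ⁻¹ φ⁻¹-hom using () renaming (hom-⁻¹ to φ⁻¹-⁻¹)
    pull : ∀ {x} → T x → T (φ⁻¹ x)
    pull {x} t = proj₂ (preserves (φ⁻¹ x)) (subst T (sym (φφ⁻¹ x)) t)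
    pulled-back : ∀ {x y} → φ⁻¹ x ≡ y → T y → T x
    pulled-back {x} refl t = subst T (φφ⁻¹ x) (proj₁ (preserves _) t)

  transpose-hit : ∀ (i j : Elt K) → transpose i j i ≡ j
  transpose-hit i j rewrite dec-true (i ≟ i) refl = refl

  transpose-miss : ∀ {i j k : Elt K} → k ≢ i → k ≢ j → transpose i j k ≡ k
  transpose-miss {i} {j} {k} k≢i k≢j rewrite dec-false (k ≟ i) k≢i | dec-false (k ≟ j) k≢j = refl

  -- Lemma: a complete or edgeless DRR has at most two vertices, since
  -- any transposition fixing ε is an automorphism.
  allOrNothing-drr : (T : Subset K) → IsDRR K T → AllOrNothing K T →
                     ∀ q q' → q ≢ ε → q' ≢ ε → q ≡ q'
  allOrNothing-drr T drr allOrNothing q q' q≢ε q'≢ε with q ≟ q'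
  ... | yes q≡q' = q≡q'
  ... | no q≢q'  = ⊥-elim (q≢q' (trans (sym (drr-rigid T drr τ ε τ-ε q)) (transpose-hit q q')))
    where
    τ-injective : ∀ {x y} → transpose q q' x ≡ transpose q q' y → x ≡ y
    τ-injective {x} {y} e =
      trans (sym (transpose-inverse q' q)) (trans (cong (transpose q' q) e) (transpose-inverse q' q))
    respects : RespectsQuotients T (transpose q q')
    respects u v with u ≟ v
    ... | yes refl = subst-⇔ T (trans (inverseʳ u) (sym (inverseʳ _)))
    ... | no u≢v = allOrNothing _ _ quotient≢ε image≢ε , allOrNothing _ _ image≢ε quotient≢ε
      where
      quotient≢ε : v ∙ u ⁻¹ ≢ ε
      quotient≢ε = distinct⇒quotient≢ε u≢v
      image≢ε : transpose q q' v ∙ transpose q q' u ⁻¹ ≢ ε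
      image≢ε = distinct⇒quotient≢ε (λ e → u≢v (τ-injective e))
    τ : DigraphAut (Cay K T)
    τ = cayleyAut T (transpose q q') (transpose q' q)
          (λ _ → transpose-inverse q' q) (λ _ → transpose-inverse q q') respects
    τ-ε : transpose q q' ε ≡ ε
    τ-ε = transpose-miss (λ e → q≢ε (sym e)) (λ e → q'≢ε (sym e))

injective⇒surjective : ∀ {n} (f : Fin n → Fin n) → Injective _≡_ _≡_ f → ∀ y → ∃ λ x → f x ≡ y
injective⇒surjective f f-inj y with any? (λ x → f x ≟ y)
... | yes hit = hit
injective⇒surjective {suc m} f f-inj y | no miss = ⊥-elim (n≮n m (injective⇒≤ g-inj))
  where
  g : Fin (suc m) → Fin m
  g x = punchOut {i = y} {j = f x} (λ e → miss (x , sym e))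
  g-inj : Injective _≡_ _≡_ g
  g-inj {x} {x'} e = f-inj (punchOut-injective (λ e → miss (x , sym e)) (λ e → miss (x' , sym e)) e)

size-unique : ∀ {n} {P : Fin n → Set} {k k'} → HasSize P k → HasSize P k' → k ≡ k'
size-unique s s' = ≤-antisym (size-≤ s s') (size-≤ s' s)
  where
  -- list the elements of the first enumeration by their indices in the second
  size-≤ : ∀ {n} {P : Fin n → Set} {k k'} → HasSize P k → HasSize P k' → k ≤ k'
  size-≤ (f , f-inj , f∈P , _) (f' , _ , _ , f'-onto) = injective⇒≤ reindex-injective
    where
    reindex : Fin _ → Fin _
    reindex i = proj₁ (f'-onto (f i) (f∈P i))
    reindex-injective : Injective _≡_ _≡_ reindex
    reindex-injective {i} {j} e = f-inj (begin
      f i               ≡⟨ sym (proj₂ (f'-onto (f i) (f∈P i))) ⟩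
      f' (reindex i)    ≡⟨ cong f' e ⟩
      f' (reindex j)    ≡⟨ proj₂ (f'-onto (f j) (f∈P j)) ⟩
      f j               ∎)
      where open ≡-Reasoning

full-size : ∀ n → HasSize {n} (λ _ → ⊤) n
full-size n = (λ i → i) , (λ e → e) , (λ _ → tt) , (λ x _ → x , refl)

enumerate : ∀ n (P : Fin n → Set) → (∀ x → Dec (P x)) → Σ ℕ (HasSize P)
enumerate zero P P? = 0 , (λ ()) , (λ {x} → ⊥-elim (¬Fin0 x)) , (λ ()) , (λ ())
enumerate (suc n) P P? with enumerate n (λ x → P (Fin.suc x)) (λ x → P? (Fin.suc x)) | P? Fin.zero
... | k , f , f-inj , f∈P , f-onto | yes P0 = suc k , g , g-inj , g∈P , g-onto
  where
  g : Fin (suc k) → Fin (suc n)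
  g Fin.zero    = Fin.zero
  g (Fin.suc i) = Fin.suc (f i)
  g-inj : Injective _≡_ _≡_ g
  g-inj {Fin.zero}  {Fin.zero}  _ = refl
  g-inj {Fin.suc i} {Fin.suc j} e = cong Fin.suc (f-inj (suc-injective e))
  g∈P : ∀ i → P (g i)
  g∈P Fin.zero    = P0
  g∈P (Fin.suc i) = f∈P i
  g-onto : ∀ x → P x → ∃ λ i → g i ≡ x
  g-onto Fin.zero    _  = Fin.zero , refl
  g-onto (Fin.suc x) Px = Fin.suc (proj₁ (f-onto x Px)) , cong Fin.suc (proj₂ (f-onto x Px))
... | k , f , f-inj , f∈P , f-onto | no ¬P0 = k , (λ i → Fin.suc (f i)) , (λ e → f-inj (suc-injective e)) , f∈P , g-onto
  where
  g-onto : ∀ x → P x → ∃ λ i → Fin.suc (f i) ≡ x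
  g-onto Fin.zero    P0 = ⊥-elim (¬P0 P0)
  g-onto (Fin.suc x) Px = proj₁ (f-onto x Px) , cong Fin.suc (proj₂ (f-onto x Px))

argmin : ∀ {k} (f : Fin k → ℕ) → Fin k → ∃ λ i → ∀ j → f i ≤ f j
argmin {suc k} f _ = argmin-suc k f
  where
  argmin-suc : ∀ k (f : Fin (suc k) → ℕ) → ∃ λ i → ∀ j → f i ≤ f j
  argmin-suc zero f = Fin.zero , λ { Fin.zero → ≤-refl }
  argmin-suc (suc k) f with argmin-suc k (λ j → f (Fin.suc j))
  ... | i , i-min with f Fin.zero ≤? f (Fin.suc i)
  ...   | yes f0≤ = Fin.zero , λ { Fin.zero → ≤-refl ; (Fin.suc j) → ≤-trans f0≤ (i-min j) }
  ...   | no f0≰  = Fin.suc i , λ { Fin.zero → ≰⇒≥ f0≰ ; (Fin.suc j) → i-min j }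

module GeneratedKit (K : FinGroup) (P : Subset K) where
  open GroupKit K

  foldr-++ : ∀ ws vs → foldr _∙_ ε (ws ++ vs) ≡ foldr _∙_ ε ws ∙ foldr _∙_ ε vs
  foldr-++ []       vs = sym (identityˡ _)
  foldr-++ (w ∷ ws) vs = trans (cong (w ∙_) (foldr-++ ws vs)) (sym (assoc _ _ _))

  generated-ε : Generated K P ε
  generated-ε = [] , [] , refl

  generated-∙ : ∀ x y → Generated K P x → Generated K P y → Generated K P (x ∙ y)
  generated-∙ _ _ (ws , ws-gen , refl) (vs , vs-gen , refl) = ws ++ vs , ++⁺ ws-gen vs-gen , sym (foldr-++ ws vs)

  generated-⁻¹ : ∀ x → Generated K P x → Generated K P (x ⁻¹)
  generated-⁻¹ _ (ws , ws-gen , refl) = inverse-of-word ws ws-gen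
    where
    flip-generator : ∀ {w} → P w ⊎ P (w ⁻¹) → P (w ⁻¹) ⊎ P ((w ⁻¹) ⁻¹)
    flip-generator {w} (inj₁ p) = inj₂ (subst P (sym (⁻¹-involutive w)) p)
    flip-generator     (inj₂ p) = inj₁ p
    -- (w ws)⁻¹ = ws⁻¹ w⁻¹
    inverse-of-word : ∀ ws → All (λ w → P w ⊎ P (w ⁻¹)) ws → Generated K P (foldr _∙_ ε ws ⁻¹)
    inverse-of-word []       []              = [] , [] , ε⁻¹≈ε
    inverse-of-word (w ∷ ws) (w-gen ∷ ws-gen) =
      subst (Generated K P) (sym (⁻¹-anti-homo-∙ w _))
        (generated-∙ _ _ (inverse-of-word ws ws-gen) ((w ⁻¹) ∷ [] , flip-generator w-gen ∷ [] , sym (identityʳ _)))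

hom-kills-generated : (K L : FinGroup) (f : Elt K → Elt L) → IsHom K L f → (P : Subset K) →
                      (∀ x → P x → f x ≡ FinGroup.ε L) → ∀ x → Generated K P x → f x ≡ FinGroup.ε L
hom-kills-generated K L f hom P kills _ (ws , ws-gen , refl) = kills-word ws ws-gen
  where
  open GroupKit L
  open HomKit K L f hom
  kills-generator : ∀ {w} → P w ⊎ P (FinGroup._⁻¹ K w) → f w ≡ ε
  kills-generator     (inj₁ p) = kills _ p
  kills-generator {w} (inj₂ p) = ⁻¹-injective (trans (sym (hom-⁻¹ w)) (trans (kills _ p) (sym ε⁻¹≈ε)))
  kills-word : ∀ ws → All (λ w → P w ⊎ P (FinGroup._⁻¹ K w)) ws → f (foldr (FinGroup._∙_ K) (FinGroup.ε K) ws) ≡ ε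
  kills-word []       []               = hom-ε
  kills-word (w ∷ ws) (w-gen ∷ ws-gen) =
    trans (hom _ _) (trans (cong₂ _∙_ (kills-generator w-gen) (kills-word ws ws-gen)) (identityˡ ε))

hom-into-centre-kills-derived : (K L : FinGroup) (f : Elt K → Elt L) → IsHom K L f →
                                (∀ x → Central L (f x)) → ∀ x → Derived K x → f x ≡ FinGroup.ε L
hom-into-centre-kills-derived K L f hom central =
  hom-kills-generated K L f hom (IsCommutator K) kills-commutator
  where
  module K = GroupKit K
  open GroupKit L
  open HomKit K L f hom
  kills-commutator : ∀ x → IsCommutator K x → f x ≡ ε
  kills-commutator _ (a , b , refl) = begin
    f (a K.⁻¹ K.∙ b K.⁻¹ K.∙ a K.∙ b)         ≡⟨ hom _ _ ⟩
    f (a K.⁻¹ K.∙ b K.⁻¹ K.∙ a) ∙ f b         ≡⟨ cong (_∙ f b) (trans (hom _ _) (cong (_∙ f a) (hom _ _))) ⟩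
    f (a K.⁻¹) ∙ f (b K.⁻¹) ∙ f a ∙ f b       ≡⟨ cong (λ w → w ∙ f (b K.⁻¹) ∙ f a ∙ f b) (hom-⁻¹ a) ⟩
    f a ⁻¹ ∙ f (b K.⁻¹) ∙ f a ∙ f b           ≡⟨ cong (_∙ f b) (assoc _ _ _) ⟩
    f a ⁻¹ ∙ (f (b K.⁻¹) ∙ f a) ∙ f b         ≡⟨ cong (λ w → f a ⁻¹ ∙ w ∙ f b) (sym (central a (f (b K.⁻¹)))) ⟩
    f a ⁻¹ ∙ (f a ∙ f (b K.⁻¹)) ∙ f b         ≡⟨ cong (_∙ f b) (x⁻¹∙[x∙y]≡y (f a) _) ⟩
    f (b K.⁻¹) ∙ f b                          ≡⟨ sym (hom _ _) ⟩
    f (b K.⁻¹ K.∙ b)                          ≡⟨ cong f (K.inverseˡ b) ⟩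
    f K.ε                                     ≡⟨ hom-ε ⟩
    ε                                         ∎
    where open ≡-Reasoning

TwoElements : (K : FinGroup) → Elt K → Set
TwoElements K x₀ = x₀ ≢ FinGroup.ε K × (∀ y → y ≡ FinGroup.ε K ⊎ y ≡ x₀)

module TwoElementKit (K : FinGroup) (x₀ : Elt K) (two : TwoElements K x₀) where
  open GroupKit K
  x₀≢ε : x₀ ≢ ε
  x₀≢ε = proj₁ two
  ε-or-x₀ : ∀ y → y ≡ ε ⊎ y ≡ x₀
  ε-or-x₀ = proj₂ two

  both-size : (P : Subset K) → P ε → P x₀ → HasSize P 2
  both-size P Pε Px₀ = pair , pair-injective , pair∈P , pair-onto
    where
    pair : Fin 2 → Elt K
    pair Fin.zero    = ε
    pair (Fin.suc _) = x₀
    pair-injective : Injective _≡_ _≡_ pair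
    pair-injective {Fin.zero}          {Fin.zero}          _ = refl
    pair-injective {Fin.zero}          {Fin.suc Fin.zero}  e = ⊥-elim (x₀≢ε (sym e))
    pair-injective {Fin.suc Fin.zero}  {Fin.zero}          e = ⊥-elim (x₀≢ε e)
    pair-injective {Fin.suc Fin.zero}  {Fin.suc Fin.zero}  _ = refl
    pair∈P : ∀ i → P (pair i)
    pair∈P Fin.zero    = Pε
    pair∈P (Fin.suc _) = Px₀
    pair-onto : ∀ y → P y → ∃ λ i → pair i ≡ y
    pair-onto y _ with ε-or-x₀ y
    ... | inj₁ y≡ε  = Fin.zero , sym y≡ε
    ... | inj₂ y≡x₀ = Fin.suc Fin.zero , sym y≡x₀

  order-two : order K ≡ 2
  order-two = size-unique (full-size _) (both-size (λ _ → ⊤) tt tt)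

  all-central : ∀ y → Central K y
  all-central y g with ε-or-x₀ y | ε-or-x₀ g
  ... | inj₁ refl | _         = trans (identityˡ g) (sym (identityʳ g))
  ... | _         | inj₁ refl = trans (identityʳ y) (sym (identityˡ y))
  ... | inj₂ refl | inj₂ refl = refl

  -- K is abelian, so its derived subgroup is {ε}
  derived-size : ∀ {a} → HasSize (Derived K) a → a ≡ 1
  derived-size size-a = size-unique size-a (singleton , (λ _ → singleton-injective) , (λ _ → generated-ε) , onto)
    where
    open GeneratedKit K (IsCommutator K) using (generated-ε)
    derived-trivial : ∀ x → Derived K x → x ≡ ε
    derived-trivial = hom-into-centre-kills-derived K K (λ x → x) (λ _ _ → refl) all-central
    singleton : Fin 1 → Elt K
    singleton _ = ε
    singleton-injective : ∀ {i j : Fin 1} → i ≡ j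
    singleton-injective {Fin.zero} {Fin.zero} = refl
    onto : ∀ y → Derived K y → ∃ λ i → singleton i ≡ y
    onto y y∈K' = Fin.zero , sym (derived-trivial y y∈K')

twoElements-pullback : (H Q : FinGroup) (m : Elt H → Elt Q) → IsHom H Q m →
                       (∀ h → m h ≡ FinGroup.ε Q → h ≡ FinGroup.ε H) →
                       ∀ {q₀ h₀} → TwoElements Q q₀ → h₀ ≢ FinGroup.ε H → TwoElements H h₀
twoElements-pullback H Q m hom m-faithful {q₀} {h₀} (_ , ε-or-q₀) h₀≢ε = h₀≢ε , ε-or-h₀
  where
  module H = GroupKit H
  open GroupKit Q
  open HomKit H Q m hom using (hom-quotient)
  image-q₀ : ∀ h → h ≢ H.ε → m h ≡ q₀
  image-q₀ h h≢ε with ε-or-q₀ (m h)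
  ... | inj₁ mh≡ε  = ⊥-elim (h≢ε (m-faithful h mh≡ε))
  ... | inj₂ mh≡q₀ = mh≡q₀
  ε-or-h₀ : ∀ h → h ≡ H.ε ⊎ h ≡ h₀
  ε-or-h₀ h with h ≟ H.ε
  ... | yes h≡ε = inj₁ h≡ε
  ... | no h≢ε  = inj₂ (H.x∙y⁻¹≈ε⇒x≈y h h₀ (m-faithful _ (begin
    m (h H.∙ h₀ H.⁻¹)  ≡⟨ hom-quotient h h₀ ⟩
    m h ∙ m h₀ ⁻¹      ≡⟨ cong₂ (λ x y → x ∙ y ⁻¹) (image-q₀ h h≢ε) (image-q₀ h₀ h₀≢ε) ⟩
    q₀ ∙ q₀ ⁻¹         ≡⟨ inverseʳ q₀ ⟩
    ε                  ∎)))
    where open ≡-Reasoning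

-- if Q and H both have two elements, |Q : Q'| = 2 = |Z(H)|
twoElements-not-coprime : (Q H : FinGroup) {q₀ : Elt Q} {h₀ : Elt H} →
                          TwoElements Q q₀ → TwoElements H h₀ → ∀ {a b z} →
                          HasSize (Derived Q) a → a * b ≡ order Q → HasSize (Central H) z → ¬ Coprime b z
twoElements-not-coprime Q H {q₀} {h₀} two-Q two-H {a} {b} {z} size-a ab≡|Q| size-z coprime =
  2≢1 (subst₂ Coprime b≡2 z≡2 coprime (∣-refl , ∣-refl))
  where
  module TQ = TwoElementKit Q q₀ two-Q
  module TH = TwoElementKit H h₀ two-H
  2≢1 : 2 ≢ 1
  2≢1 ()
  b≡2 : b ≡ 2
  b≡2 = begin
    b          ≡⟨ sym (*-identityˡ b) ⟩
    1 * b      ≡⟨ cong (_* b) (sym (TQ.derived-size size-a)) ⟩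
    a * b      ≡⟨ ab≡|Q| ⟩
    order Q    ≡⟨ TQ.order-two ⟩
    2          ∎
    where open ≡-Reasoning
  z≡2 : z ≡ 2
  z≡2 = size-unique size-z (TH.both-size (Central H) (TH.all-central _) (TH.all-central h₀))

-- In every left coset qE the element with the least index is chosen as
-- representative; there are `index` of them and index · a = |Q|.
module CosetKit (Q : FinGroup) (E : Subset Q) (E-ε : E (FinGroup.ε Q))
                (E-∙ : ∀ x y → E x → E y → E (FinGroup._∙_ Q x y))
                (E-⁻¹ : ∀ x → E x → E (FinGroup._⁻¹ Q x))
                {a : ℕ} (size-E : HasSize E a) where
  open GroupKit Q

  element : Fin a → Elt Q
  element = proj₁ size-E
  element-injective : Injective _≡_ _≡_ element
  element-injective = proj₁ (proj₂ size-E)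
  element∈E : ∀ j → E (element j)
  element∈E = proj₁ (proj₂ (proj₂ size-E))
  element-onto : ∀ x → E x → ∃ λ j → element j ≡ x
  element-onto = proj₂ (proj₂ (proj₂ size-E))

  IsMinimal : Elt Q → Set
  IsMinimal q = ∀ j → toℕ q ≤ toℕ (q ∙ element j)

  minimal-≤ : ∀ {x} d → IsMinimal x → E d → toℕ x ≤ toℕ (x ∙ d)
  minimal-≤ {x} d x-min d∈E with element-onto d d∈E
  ... | j , refl = x-min j

  minimal-unique : ∀ {x y} d → IsMinimal x → IsMinimal y → E d → y ≡ x ∙ d → x ≡ y
  minimal-unique {x} {y} d x-min y-min d∈E refl = toℕ-injective (≤-antisym
    (minimal-≤ d x-min d∈E)
    (subst (λ w → toℕ (x ∙ d) ≤ toℕ w) ([y∙x]∙x⁻¹≡y d x) (minimal-≤ (d ⁻¹) y-min (E-⁻¹ d d∈E))))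

  representatives : Σ ℕ (HasSize IsMinimal)
  representatives = enumerate _ IsMinimal (λ q → all? (λ j → toℕ q ≤? toℕ (q ∙ element j)))

  index : ℕ
  index = proj₁ representatives
  rep : Fin index → Elt Q
  rep = proj₁ (proj₂ representatives)
  rep-injective : Injective _≡_ _≡_ rep
  rep-injective = proj₁ (proj₂ (proj₂ representatives))
  rep-minimal : ∀ i → IsMinimal (rep i)
  rep-minimal = proj₁ (proj₂ (proj₂ (proj₂ representatives)))
  rep-onto : ∀ q → IsMinimal q → ∃ λ i → rep i ≡ q
  rep-onto = proj₂ (proj₂ (proj₂ (proj₂ representatives)))

  least-minimal : ∀ q j₀ → (∀ j → toℕ (q ∙ element j₀) ≤ toℕ (q ∙ element j)) → IsMinimal (q ∙ element j₀)
  least-minimal q j₀ least j with element-onto _ (E-∙ _ _ (element∈E j₀) (element∈E j))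
  ... | k , element-k≡ = subst (λ w → toℕ (q ∙ element j₀) ≤ toℕ w)
                               (trans (cong (q ∙_) element-k≡) (sym (assoc _ _ _))) (least k)

  cover : ∀ q → ∃ λ i → E (rep i ⁻¹ ∙ q)
  cover q with argmin (λ j → toℕ (q ∙ element j)) (proj₁ (element-onto ε E-ε))
  ... | j₀ , least with rep-onto (q ∙ element j₀) (least-minimal q j₀ least)
  ...   | i , rep-i≡ = i , subst (λ w → E (w ⁻¹ ∙ q)) (sym rep-i≡) (subst E (sym quotient) (E-⁻¹ _ (element∈E j₀)))
    where
    quotient : (q ∙ element j₀) ⁻¹ ∙ q ≡ element j₀ ⁻¹
    quotient = begin
      (q ∙ element j₀) ⁻¹ ∙ q              ≡⟨ cong (_∙ q) (⁻¹-anti-homo-∙ q _) ⟩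
      element j₀ ⁻¹ ∙ q ⁻¹ ∙ q             ≡⟨ [y∙x⁻¹]∙x≡y q _ ⟩
      element j₀ ⁻¹                        ∎
      where open ≡-Reasoning

  separate : ∀ i i' → E (rep i ⁻¹ ∙ rep i') → i ≡ i'
  separate i i' d∈E = rep-injective (minimal-unique _ (rep-minimal i) (rep-minimal i') d∈E
                                      (sym (x∙[x⁻¹∙y]≡y (rep i) (rep i'))))

  -- Lagrange: (i , j) ↦ rep i ∙ element j is a bijection Fin (index · a) ≅ Q
  lagrange : index * a ≡ order Q
  lagrange = size-unique (product , product-injective , (λ _ → tt) , product-onto) (full-size _)
    where
    product : Fin (index * a) → Elt Q
    product x = rep (proj₁ (remQuot {index} a x)) ∙ element (proj₂ (remQuot {index} a x))
    pair-injective : ∀ {i j i' j'} → rep i ∙ element j ≡ rep i' ∙ element j' → (i , j) ≡ (i' , j')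
    pair-injective {i} {j} {i'} {j'} e with separate i i' (subst E quotient (E-∙ _ _ (element∈E j) (E-⁻¹ _ (element∈E j'))))
      where
      quotient : element j ∙ element j' ⁻¹ ≡ rep i ⁻¹ ∙ rep i'
      quotient = moveˡ (rep i) _ _ (trans (sym (assoc _ _ _)) (sym (moveʳ (rep i') (element j') _ (sym e))))
    ... | refl = cong (i ,_) (element-injective (∙-cancelˡ (rep i) _ _ e))
    product-injective : Injective _≡_ _≡_ product
    product-injective {x} {y} e = trans (sym (combine-remQuot {index} a x))
      (trans (cong (λ p → combine (proj₁ p) (proj₂ p)) (pair-injective e)) (combine-remQuot {index} a y))
    product-onto : ∀ q → ⊤ → ∃ λ x → product x ≡ q
    product-onto q _ with cover q
    ... | i , d∈E with element-onto _ d∈E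
    ...   | j , e≡d = combine i j , (begin
      product (combine i j)       ≡⟨ cong (λ p → rep (proj₁ p) ∙ element (proj₂ p)) (remQuot-combine {index} {a} i j) ⟩
      rep i ∙ element j           ≡⟨ cong (rep i ∙_) e≡d ⟩
      rep i ∙ (rep i ⁻¹ ∙ q)      ≡⟨ x∙[x⁻¹∙y]≡y (rep i) q ⟩
      q                           ∎)
      where open ≡-Reasoning

-- The centre Z(H) as a commutative monoid (compared by underlying
-- elements), with powers u ^ n taken from the library's monoid multiples.
module CentreKit (H : FinGroup) where
  open GroupKit H

  Centre : Set
  Centre = Σ (Elt H) (Central H)

  _·_ : Centre → Centre → Centre
  (x , x-central) · (y , y-central) = x ∙ y , λ g → begin
    x ∙ y ∙ g      ≡⟨ assoc x y g ⟩
    x ∙ (y ∙ g)    ≡⟨ cong (x ∙_) (y-central g) ⟩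
    x ∙ (g ∙ y)    ≡⟨ sym (assoc x g y) ⟩
    x ∙ g ∙ y      ≡⟨ cong (_∙ y) (x-central g) ⟩
    g ∙ x ∙ y      ≡⟨ assoc g x y ⟩
    g ∙ (x ∙ y)    ∎
    where open ≡-Reasoning

  one : Centre
  one = ε , λ g → trans (identityˡ g) (sym (identityʳ g))

  centreMonoid : CommutativeMonoid 0ℓ 0ℓ
  centreMonoid = record
    { Carrier = Centre ; _≈_ = λ x y → proj₁ x ≡ proj₁ y ; _∙_ = _·_ ; ε = one
    ; isCommutativeMonoid = record
      { isMonoid = record
        { isSemigroup = record
          { isMagma = record { isEquivalence = record { refl = refl ; sym = sym ; trans = trans }
                             ; ∙-cong = cong₂ _∙_ }
          ; assoc = λ x y z → assoc (proj₁ x) (proj₁ y) (proj₁ z) }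
        ; identity = (λ x → identityˡ (proj₁ x)) , (λ x → identityʳ (proj₁ x)) }
      ; comm = λ x y → proj₂ x (proj₁ y) } }

  open import Algebra.Properties.CommutativeMonoid.Sum centreMonoid
    using (sum; sum-permute; sum-cong-≋; ∑-distrib-+; sum-replicate)
  open import Algebra.Properties.Monoid.Mult (CommutativeMonoid.monoid centreMonoid)
    using (×-homo-+) renaming (_×_ to _times_)

  _^_ : Centre → ℕ → Centre
  u ^ n = n times u

  -- transfer argument: if multiplication by u permutes a family F of n
  -- central elements, then Π F = uⁿ Π F, so uⁿ = ε
  transfer : ∀ {n} (F : Fin n → Centre) (u : Centre) (s : Fin n → Fin n) → Injective _≡_ _≡_ s →
             (∀ i → proj₁ (u · F i) ≡ proj₁ (F (s i))) → proj₁ (u ^ n) ≡ ε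
  transfer {n} F u s s-injective shifts =
    ∙-cancelʳ (proj₁ (sum F)) _ _ (trans (sym product-shifted) (sym (identityˡ _)))
    where
    s⁻¹ : Fin n → Fin n
    s⁻¹ y = proj₁ (injective⇒surjective s s-injective y)
    s-permutation : Permutation n n
    s-permutation = permutation s s⁻¹ (λ y → proj₂ (injective⇒surjective s s-injective y))
                                      (λ x → s-injective (proj₂ (injective⇒surjective s s-injective (s x))))
    product-shifted : proj₁ (sum F) ≡ proj₁ (u ^ n) ∙ proj₁ (sum F)
    product-shifted = begin
      proj₁ (sum F)                          ≡⟨ sum-permute F s-permutation ⟩
      proj₁ (sum (λ i → F (s i)))            ≡⟨ sum-cong-≋ {n} (λ i → sym (shifts i)) ⟩
      proj₁ (sum (λ i → u · F i))            ≡⟨ ∑-distrib-+ {n} (λ _ → u) F ⟩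
      proj₁ (sum {n} (λ _ → u) · sum F)      ≡⟨ cong (_∙ proj₁ (sum F)) (sum-replicate n) ⟩
      proj₁ (u ^ n) ∙ proj₁ (sum F)          ∎
      where open ≡-Reasoning

  centre-exponent : ∀ {z} → HasSize (Central H) z → ∀ u → proj₁ (u ^ z) ≡ ε
  centre-exponent {z} (f , f-injective , f-central , f-onto) u =
    transfer (λ i → f i , f-central i) u s s-injective (λ i → proj₂ (shifted i))
    where
    shifted : ∀ i → ∃ λ j → proj₁ (u · (f i , f-central i)) ≡ f j
    shifted i with f-onto _ (proj₂ (u · (f i , f-central i)))
    ... | j , fj≡ = j , sym fj≡
    s : Fin z → Fin z
    s i = proj₁ (shifted i)
    s-injective : Injective _≡_ _≡_ s
    s-injective {i} {j} e = f-injective (∙-cancelˡ (proj₁ u) _ _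
      (trans (proj₂ (shifted i)) (trans (cong f e) (sym (proj₂ (shifted j))))))

  power-multiple : ∀ n u → proj₁ (u ^ n) ≡ ε → ∀ k → proj₁ (u ^ (k * n)) ≡ ε
  power-multiple n u uⁿ≡ε zero    = refl
  power-multiple n u uⁿ≡ε (suc k) = begin
    proj₁ (u ^ (n + k * n))                ≡⟨ ×-homo-+ u n (k * n) ⟩
    proj₁ (u ^ n) ∙ proj₁ (u ^ (k * n))    ≡⟨ cong₂ _∙_ uⁿ≡ε (power-multiple n u uⁿ≡ε k) ⟩
    ε ∙ ε                                  ≡⟨ identityʳ ε ⟩
    ε                                      ∎
    where open ≡-Reasoning

  -- u = u · uᵐ = u^(1+m) whenever uᵐ = ε
  power-cancel : ∀ u m n → proj₁ (u ^ m) ≡ ε → suc m ≡ n → proj₁ (u ^ n) ≡ ε → proj₁ u ≡ ε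
  power-cancel u m n uᵐ≡ε refl uⁿ≡ε = begin
    proj₁ u                    ≡⟨ sym (identityʳ _) ⟩
    proj₁ u ∙ ε                ≡⟨ cong (proj₁ u ∙_) (sym uᵐ≡ε) ⟩
    proj₁ (u ^ suc m)          ≡⟨ uⁿ≡ε ⟩
    ε                          ∎
    where open ≡-Reasoning

  coprime-exponents : ∀ {b z} → Coprime b z → ∀ u →
                      proj₁ (u ^ b) ≡ ε → proj₁ (u ^ z) ≡ ε → proj₁ u ≡ ε
  coprime-exponents {b} {z} coprime u uᵇ≡ε uᶻ≡ε with coprime-Bézout coprime
  ... | Bézout.+- x y eq = power-cancel u (y * z) (x * b) (power-multiple z u uᶻ≡ε y) eq (power-multiple b u uᵇ≡ε x)
  ... | Bézout.-+ x y eq = power-cancel u (x * b) (y * z) (power-multiple b u uᵇ≡ε x) eq (power-multiple z u uᶻ≡ε y)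

-- C kills Q', so left multiplication by
-- g permutes the values of C on coset representatives of Q', giving
-- C(g)^|Q:Q'| = ε; and C(g)^|Z(H)| = ε as C(g) ∈ Z(H).
module CoprimeHom (Q H : FinGroup) (C : Elt Q → Elt H) (hom : IsHom Q H C) (central : ∀ q → Central H (C q))
                  {a b z : ℕ} (size-a : HasSize (Derived Q) a) (ab≡|Q| : a * b ≡ order Q)
                  (size-z : HasSize (Central H) z) (coprime : Coprime b z) where
  module Q = GroupKit Q
  open GroupKit H
  open CentreKit H
  open GeneratedKit Q (IsCommutator Q)
  open CosetKit Q (Derived Q) generated-ε generated-∙ generated-⁻¹ size-a

  index≡b : index ≡ b
  index≡b = cancel (proj₁ (element-onto Q.ε generated-ε)) (trans lagrange (trans (sym ab≡|Q|) (*-comm a b)))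
    where
    cancel : ∀ {a} → Fin a → index * a ≡ b * a → index ≡ b
    cancel {suc a'} _ = *-cancelʳ-≡ index b (suc a')

  module Translation (g : Elt Q) where
    Cg : Centre
    Cg = C g , central g

    s : Fin index → Fin index
    s i = proj₁ (cover (g Q.∙ rep i))
    d : Fin index → Elt Q
    d i = rep (s i) Q.⁻¹ Q.∙ (g Q.∙ rep i)
    d∈Q' : ∀ i → Derived Q (d i)
    d∈Q' i = proj₂ (cover (g Q.∙ rep i))

    s-injective : Injective _≡_ _≡_ s
    s-injective {i} {i'} e = separate i i' (subst (Derived Q) same-coset
      (generated-∙ _ _ (generated-⁻¹ _ (d∈Q' i)) (subst (λ k → Derived Q (rep k Q.⁻¹ Q.∙ (g Q.∙ rep i'))) (sym e) (d∈Q' i'))))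
      where
      same-coset : d i Q.⁻¹ Q.∙ (rep (s i) Q.⁻¹ Q.∙ (g Q.∙ rep i')) ≡ rep i Q.⁻¹ Q.∙ rep i'
      same-coset = trans (Q.[x∙y]⁻¹∙[x∙y']≡y⁻¹∙y' (rep (s i) Q.⁻¹) _ _) (Q.[x∙y]⁻¹∙[x∙y']≡y⁻¹∙y' g _ _)

    shifts : ∀ i → C g ∙ C (rep i) ≡ C (rep (s i))
    shifts i = begin
      C g ∙ C (rep i)                 ≡⟨ sym (hom g (rep i)) ⟩
      C (g Q.∙ rep i)                 ≡⟨ cong C (sym (Q.x∙[x⁻¹∙y]≡y (rep (s i)) _)) ⟩
      C (rep (s i) Q.∙ d i)           ≡⟨ hom _ _ ⟩
      C (rep (s i)) ∙ C (d i)         ≡⟨ cong (C (rep (s i)) ∙_) (hom-into-centre-kills-derived Q H C hom central _ (d∈Q' i)) ⟩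
      C (rep (s i)) ∙ ε               ≡⟨ identityʳ _ ⟩
      C (rep (s i))                   ∎
      where open ≡-Reasoning

    power-index : proj₁ (Cg ^ b) ≡ ε
    power-index = subst (λ n → proj₁ (Cg ^ n) ≡ ε) index≡b
      (transfer (λ i → C (rep i) , central (rep i)) Cg s s-injective shifts)

  hom-to-centre-trivial : ∀ g → C g ≡ ε
  hom-to-centre-trivial g = coprime-exponents coprime Cg power-index (centre-exponent size-z Cg)
    where open Translation g

module Extension (G H Q : FinGroup) (ι : Elt H → Elt G) (π : Elt G → Elt Q)
  (ι-hom : IsHom H G ι) (ι-injective : Injective _≡_ _≡_ ι)
  (π-hom : IsHom G Q π) (π-surjective : ∀ q → ∃ λ g → π g ≡ q)
  (kernel : ∀ g → (π g ≡ FinGroup.ε Q → ∃ λ h → ι h ≡ g) × ((∃ λ h → ι h ≡ g) → π g ≡ FinGroup.ε Q))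
  where

  open GroupKit G
  module H = GroupKit H
  module Q = GroupKit Q
  module ι = HomKit H G ι ι-hom
  module π = HomKit G Q π π-hom

  -- N is handled as the kernel of π, which is decidable
  N : Subset G
  N x = π x ≡ Q.ε

  N? : ∀ x → Dec (N x)
  N? x = π x ≟ Q.ε

  lift : ∀ x → N x → Elt H
  lift x x∈N = proj₁ (proj₁ (kernel x) x∈N)

  ι-lift : ∀ x (x∈N : N x) → ι (lift x x∈N) ≡ x
  ι-lift x x∈N = proj₂ (proj₁ (kernel x) x∈N)

  ι∈N : ∀ h → N (ι h)
  ι∈N h = proj₂ (kernel (ι h)) (h , refl)

  σ : Elt Q → Elt G
  σ q = proj₁ (π-surjective q)

  πσ : ∀ q → π (σ q) ≡ q
  πσ q = proj₂ (π-surjective q)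

  σ-∙ : ∀ q q' → π (σ (q Q.∙ q')) ≡ π (σ q ∙ σ q')
  σ-∙ q q' = trans (πσ _) (sym (trans (π-hom _ _) (cong₂ Q._∙_ (πσ q) (πσ q'))))

  N-∙ : ∀ x y → N x → N y → N (x ∙ y)
  N-∙ x y x∈N y∈N = trans (π-hom x y) (trans (cong₂ Q._∙_ x∈N y∈N) (Q.identityˡ Q.ε))

  N-⁻¹ : ∀ x → N x → N (x ⁻¹)
  N-⁻¹ x x∈N = trans (π.hom-⁻¹ x) (trans (cong Q._⁻¹ x∈N) Q.ε⁻¹≈ε)

  π-absorbʳ : ∀ x n → N n → π (x ∙ n) ≡ π x
  π-absorbʳ x n n∈N = trans (π-hom x n) (trans (cong (π x Q.∙_) n∈N) (Q.identityʳ _))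

  π-absorbˡ : ∀ x n → N n → π (n ∙ x) ≡ π x
  π-absorbˡ x n n∈N = trans (π-hom n x) (trans (cong (Q._∙ π x) n∈N) (Q.identityˡ _))

  same-coset : ∀ x y → π x ≡ π y → N (x ⁻¹ ∙ y)
  same-coset x y πx≡πy = begin
    π (x ⁻¹ ∙ y)         ≡⟨ π-hom _ _ ⟩
    π (x ⁻¹) Q.∙ π y     ≡⟨ cong (Q._∙ π y) (trans (π.hom-⁻¹ x) (cong Q._⁻¹ πx≡πy)) ⟩
    π y Q.⁻¹ Q.∙ π y     ≡⟨ Q.inverseˡ _ ⟩
    Q.ε                  ∎
    where open ≡-Reasoning

  kills-N⇒coset-constant : (L : FinGroup) (f : Elt G → Elt L) → IsHom G L f →
                           (∀ h → f (ι h) ≡ FinGroup.ε L) → ∀ x y → π x ≡ π y → f x ≡ f y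
  kills-N⇒coset-constant L f f-hom kills x y πx≡πy = begin
    f x                          ≡⟨ sym (L.identityʳ _) ⟩
    f x L.∙ L.ε                  ≡⟨ cong (f x L.∙_) (sym (trans (cong f (sym (ι-lift _ n∈N))) (kills _))) ⟩
    f x L.∙ f (x ⁻¹ ∙ y)         ≡⟨ sym (f-hom _ _) ⟩
    f (x ∙ (x ⁻¹ ∙ y))           ≡⟨ cong f (x∙[x⁻¹∙y]≡y x y) ⟩
    f y                          ∎
    where
    module L = GroupKit L
    open ≡-Reasoning
    n∈N : N (x ⁻¹ ∙ y)
    n∈N = same-coset x y πx≡πy

  module Restriction (φ : GroupAut G) (φ-N : ∀ h → N (GroupAut.fun φ (ι h)))
                     (φ⁻¹-N : ∀ h → N (GroupAut.invFun φ (ι h))) where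
    open GroupAut φ

    restrict : GroupAut H
    restrict = record
      { fun = λ h → lift _ (φ-N h)
      ; invFun = λ h → lift _ (φ⁻¹-N h)
      ; hom = λ x y → ι-injective (begin
          ι (lift _ (φ-N (x H.∙ y)))                     ≡⟨ ι-lift _ _ ⟩
          fun (ι (x H.∙ y))                              ≡⟨ cong fun (ι-hom x y) ⟩
          fun (ι x ∙ ι y)                                ≡⟨ hom _ _ ⟩
          fun (ι x) ∙ fun (ι y)                          ≡⟨ sym (cong₂ _∙_ (ι-lift _ _) (ι-lift _ _)) ⟩
          ι (lift _ (φ-N x)) ∙ ι (lift _ (φ-N y))        ≡⟨ sym (ι-hom _ _) ⟩
          ι (lift _ (φ-N x) H.∙ lift _ (φ-N y))          ∎)
      ; leftInv = λ h → ι-injective (trans (ι-lift _ _) (trans (cong invFun (ι-lift _ _)) (leftInv (ι h))))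
      ; rightInv = λ h → ι-injective (trans (ι-lift _ _) (trans (cong fun (ι-lift _ _)) (rightInv (ι h)))) }
      where open ≡-Reasoning

    ι-restrict : ∀ h → ι (GroupAut.fun restrict h) ≡ fun (ι h)
    ι-restrict h = ι-lift _ (φ-N h)

    private
      πφ-coset-constant : ∀ x y → π x ≡ π y → π (fun x) ≡ π (fun y)
      πφ-coset-constant = kills-N⇒coset-constant Q (λ g → π (fun g))
        (λ x y → trans (cong π (hom x y)) (π-hom _ _)) φ-N
      πφ⁻¹-coset-constant : ∀ x y → π x ≡ π y → π (invFun x) ≡ π (invFun y)
      πφ⁻¹-coset-constant = kills-N⇒coset-constant Q (λ g → π (invFun g))
        (λ x y → trans (cong π (GroupAut.hom (inverseAut φ) x y)) (π-hom _ _)) φ⁻¹-N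

    induce : GroupAut Q
    induce = record
      { fun = λ q → π (fun (σ q))
      ; invFun = λ q → π (invFun (σ q))
      ; hom = λ q q' → trans (πφ-coset-constant _ _ (σ-∙ q q')) (trans (cong π (hom _ _)) (π-hom _ _))
      ; leftInv = λ q → trans (πφ⁻¹-coset-constant _ _ (πσ _)) (trans (cong π (leftInv _)) (πσ q))
      ; rightInv = λ q → trans (πφ-coset-constant _ _ (πσ _)) (trans (cong π (rightInv _)) (πσ q)) }

    π-induce : ∀ g → π (fun g) ≡ GroupAut.fun induce (π g)
    π-induce g = πφ-coset-constant g (σ (π g)) (sym (πσ (π g)))

  -- An
  -- automorphism φ acting trivially on N and on G/N is trivial: the map
  -- c(g) = g⁻¹ φ(g) takes values in N, centralises N, hence lands in
  -- Z(N) ≤ Z(G); so c is a homomorphism killing N, i.e. a homomorphism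
  -- Q → Z(N), which is trivial by coprimality.
  module CentralAutomorphism (centre-N≤centre-G : ∀ h → Central H h → Central G (ι h))
    {a b z : ℕ} (size-a : HasSize (Derived Q) a) (ab≡|Q| : a * b ≡ order Q)
    (size-z : HasSize (Central H) z) (coprime : Coprime b z)
    (φ : GroupAut G) (fixes-N : ∀ h → GroupAut.fun φ (ι h) ≡ ι h)
    (fixes-Q : ∀ g → π (GroupAut.fun φ g) ≡ π g) where
    open GroupAut φ
    module φ = HomKit G G fun hom

    c : Elt G → Elt G
    c x = x ⁻¹ ∙ fun x

    c∈N : ∀ x → N (c x)
    c∈N x = same-coset x (fun x) (sym (fixes-Q x))

    cH : Elt G → Elt H
    cH x = lift (c x) (c∈N x)

    ι-cH : ∀ x → ι (cH x) ≡ c x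
    ι-cH x = ι-lift (c x) (c∈N x)

    -- φ fixes the conjugate x (ι h) x⁻¹ ∈ N, forcing c x to commute with ι h
    c-commutes : ∀ x h → c x ∙ ι h ≡ ι h ∙ c x
    c-commutes x h = trans (sym ([y∙x⁻¹]∙x≡y (c x) _)) (cong (_∙ c x) conj-c-fixed)
      where
      n : Elt G
      n = x ∙ ι h ∙ x ⁻¹
      n∈N : N n
      n∈N = trans (π-hom _ _) (trans (cong (Q._∙ π (x ⁻¹)) (π-absorbʳ x (ι h) (ι∈N h)))
                                     (trans (sym (π-hom _ _)) (trans (cong π (inverseʳ x)) π.hom-ε)))
      conj-c-fixed : c x ∙ ι h ∙ c x ⁻¹ ≡ ι h
      conj-c-fixed = ∙-cancelˡ x _ _ (∙-cancelʳ (x ⁻¹) _ _ (begin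
        x ∙ (c x ∙ ι h ∙ c x ⁻¹) ∙ x ⁻¹       ≡⟨ sym (conjugate-∙ x (c x) (ι h)) ⟩
        x ∙ c x ∙ ι h ∙ (x ∙ c x) ⁻¹          ≡⟨ cong (λ y → y ∙ ι h ∙ y ⁻¹) (x∙[x⁻¹∙y]≡y x (fun x)) ⟩
        fun x ∙ ι h ∙ fun x ⁻¹                ≡⟨ cong₂ (λ y w → fun x ∙ y ∙ w) (sym (fixes-N h)) (sym (φ.hom-⁻¹ x)) ⟩
        fun x ∙ fun (ι h) ∙ fun (x ⁻¹)        ≡⟨ sym (trans (hom _ _) (cong (_∙ fun (x ⁻¹)) (hom _ _))) ⟩
        fun n                                 ≡⟨ cong fun (sym (ι-lift n n∈N)) ⟩
        fun (ι (lift n n∈N))                  ≡⟨ fixes-N _ ⟩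
        ι (lift n n∈N)                        ≡⟨ ι-lift n n∈N ⟩
        n                                     ∎))
        where open ≡-Reasoning

    cH-central : ∀ x → Central H (cH x)
    cH-central x h = ι-injective (begin
      ι (cH x H.∙ h)      ≡⟨ trans (ι-hom _ _) (cong (_∙ ι h) (ι-cH x)) ⟩
      c x ∙ ι h           ≡⟨ c-commutes x h ⟩
      ι h ∙ c x           ≡⟨ sym (trans (ι-hom _ _) (cong (ι h ∙_) (ι-cH x))) ⟩
      ι (h H.∙ cH x)      ∎)
      where open ≡-Reasoning

    c-central : ∀ x → Central G (c x)
    c-central x = subst (Central G) (ι-cH x) (centre-N≤centre-G (cH x) (cH-central x))

    -- c(xy) = y⁻¹ c(x) φ(y) = c(x) c(y), as c(x) is central
    c-hom : ∀ x y → c (x ∙ y) ≡ c x ∙ c y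
    c-hom x y = begin
      (x ∙ y) ⁻¹ ∙ fun (x ∙ y)            ≡⟨ cong₂ _∙_ (⁻¹-anti-homo-∙ x y) (hom x y) ⟩
      y ⁻¹ ∙ x ⁻¹ ∙ (fun x ∙ fun y)       ≡⟨ sym (assoc _ _ _) ⟩
      y ⁻¹ ∙ x ⁻¹ ∙ fun x ∙ fun y         ≡⟨ cong (_∙ fun y) (assoc _ _ _) ⟩
      y ⁻¹ ∙ c x ∙ fun y                  ≡⟨ cong (_∙ fun y) (sym (c-central x (y ⁻¹))) ⟩
      c x ∙ y ⁻¹ ∙ fun y                  ≡⟨ assoc _ _ _ ⟩
      c x ∙ c y                           ∎
      where open ≡-Reasoning

    cH-hom : IsHom G H cH
    cH-hom x y = ι-injective (trans (ι-cH _) (trans (c-hom x y)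
      (sym (trans (ι-hom _ _) (cong₂ _∙_ (ι-cH x) (ι-cH y))))))

    cH-kills-N : ∀ h → cH (ι h) ≡ H.ε
    cH-kills-N h = ι-injective (trans (ι-cH _) (trans (cong (ι h ⁻¹ ∙_) (fixes-N h))
                                                      (trans (inverseˡ _) (sym ι.hom-ε))))

    -- cH kills N, so it factors through Q as C = cH ∘ σ
    cH-coset-constant : ∀ x y → π x ≡ π y → cH x ≡ cH y
    cH-coset-constant = kills-N⇒coset-constant H cH cH-hom cH-kills-N

    C : Elt Q → Elt H
    C q = cH (σ q)

    C-hom : IsHom Q H C
    C-hom q q' = trans (cH-coset-constant _ _ (σ-∙ q q')) (cH-hom _ _)

    cH-trivial : ∀ x → cH x ≡ H.ε
    cH-trivial x = trans (cH-coset-constant x (σ (π x)) (sym (πσ (π x))))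
      (CoprimeHom.hom-to-centre-trivial Q H C C-hom (λ q → cH-central (σ q)) size-a ab≡|Q| size-z coprime (π x))

    central-automorphism-trivial : ∀ g → fun g ≡ g
    central-automorphism-trivial g = begin
      fun g              ≡⟨ inverseʳ-unique (g ⁻¹) (fun g) c≡ε ⟩
      g ⁻¹ ⁻¹            ≡⟨ ⁻¹-involutive g ⟩
      g                  ∎
      where
      open ≡-Reasoning
      c≡ε : c g ≡ ε
      c≡ε = trans (sym (ι-cH g)) (trans (cong ι (cH-trivial g)) ι.hom-ε)

  module Lifted (S̄₁ : Subset Q) (S₂ : Subset H) where
    S : Subset G
    S = LiftUnion G H Q ι π S̄₁ S₂

    S-outside : ∀ x → S x → ¬ N x → S̄₁ (π x)
    S-outside x (inj₁ t)                _   = t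
    S-outside x (inj₂ (h , refl , _))   x∉N = ⊥-elim (x∉N (ι∈N h))

    S-inside : Loopless Q S̄₁ → ∀ h → S (ι h) → S₂ h
    S-inside loopless h (inj₁ t)              = ⊥-elim (loopless (subst S̄₁ (ι∈N h) t))
    S-inside loopless h (inj₂ (h' , e , s))   = subst S₂ (ι-injective e) s

    -- S ∖ N = π⁻¹(S̄₁) is a union of cosets of N
    N-absorbing : Absorbing G S
    N-absorbing = record
      { D = N ; D? = N? ; D-∙ = N-∙ ; D-⁻¹ = N-⁻¹
      ; absorbʳ = λ x n x∉N n∈N t → inj₁ (subst S̄₁ (sym (π-absorbʳ x n n∈N)) (S-outside x t x∉N))
      ; absorbˡ = λ x n x∉N n∈N t → inj₁ (subst S̄₁ (sym (π-absorbˡ x n n∈N)) (S-outside x t x∉N)) }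

    S-inverseClosed : InverseClosed Q S̄₁ → InverseClosed H S₂ → InverseClosed G S
    S-inverseClosed closed₁ closed₂ x (inj₁ t) = inj₁ (subst S̄₁ (sym (π.hom-⁻¹ x)) (closed₁ _ t))
    S-inverseClosed closed₁ closed₂ x (inj₂ (h , refl , s)) = inj₂ (h H.⁻¹ , ι.hom-⁻¹ h , closed₂ h s)

    module _ (A : Absorbing G S) where
      open Absorbing A

      ImageD : Subset Q
      ImageD q = ∃ λ g → D g × π g ≡ q

      image-absorbing : Absorbing Q S̄₁
      image-absorbing = record
        { D = ImageD
        ; D? = λ q → any? (λ g → D? g ×-dec (π g ≟ q))
        ; D-∙ = λ { _ _ (g , Dg , refl) (g' , Dg' , refl) → g ∙ g' , D-∙ g g' Dg Dg' , π-hom g g' }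
        ; D-⁻¹ = λ { _ (g , Dg , refl) → g ⁻¹ , D-⁻¹ g Dg , π.hom-⁻¹ g }
        ; absorbʳ = absorbʳ-image
        ; absorbˡ = absorbˡ-image }
        where
        σ∉D : ∀ {q} → ¬ ImageD q → ¬ D (σ q)
        σ∉D {q} q∉πD σq∈D = q∉πD (σ q , σq∈D , πσ q)
        σ∈S : ∀ {q} → S̄₁ q → S (σ q)
        σ∈S {q} t = inj₁ (subst S̄₁ (sym (πσ q)) t)
        absorbʳ-image : ∀ q d → ¬ ImageD q → ImageD d → S̄₁ q → S̄₁ (q Q.∙ d)
        absorbʳ-image q _ q∉πD (k , k∈D , refl) t =
          subst S̄₁ π-product (S-outside _ (absorbʳ _ _ (σ∉D q∉πD) k∈D (σ∈S t)) product∉N)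
          where
          π-product : π (σ q ∙ k) ≡ q Q.∙ π k
          π-product = trans (π-hom _ _) (cong (Q._∙ π k) (πσ q))
          product∉N : ¬ N (σ q ∙ k)
          product∉N e = q∉πD (k ⁻¹ , D-⁻¹ k k∈D ,
            trans (π.hom-⁻¹ k) (sym (Q.inverseˡ-unique q (π k) (trans (sym π-product) e))))
        absorbˡ-image : ∀ q d → ¬ ImageD q → ImageD d → S̄₁ q → S̄₁ (d Q.∙ q)
        absorbˡ-image q _ q∉πD (k , k∈D , refl) t =
          subst S̄₁ π-product (S-outside _ (absorbˡ _ _ (σ∉D q∉πD) k∈D (σ∈S t)) product∉N)
          where
          π-product : π (k ∙ σ q) ≡ π k Q.∙ q
          π-product = trans (π-hom _ _) (cong (π k Q.∙_) (πσ q))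
          product∉N : ¬ N (k ∙ σ q)
          product∉N e = q∉πD (k ⁻¹ , D-⁻¹ k k∈D ,
            trans (π.hom-⁻¹ k) (sym (Q.inverseʳ-unique (π k) q (trans (sym π-product) e))))

      preimage-absorbing : Loopless Q S̄₁ → Absorbing H S₂
      preimage-absorbing loopless = record
        { D = λ h → D (ι h)
        ; D? = λ h → D? (ι h)
        ; D-∙ = λ x y Dx Dy → subst D (sym (ι-hom x y)) (D-∙ _ _ Dx Dy)
        ; D-⁻¹ = λ x Dx → subst D (sym (ι.hom-⁻¹ x)) (D-⁻¹ _ Dx)
        ; absorbʳ = λ h d h∉D d∈D s → S-inside loopless _
            (subst S (sym (ι-hom h d)) (absorbʳ (ι h) (ι d) h∉D d∈D (inj₂ (h , refl , s))))
        ; absorbˡ = λ h d h∉D d∈D s → S-inside loopless _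
            (subst S (sym (ι-hom d h)) (absorbˡ (ι h) (ι d) h∉D d∈D (inj₂ (h , refl , s)))) }

      -- If D is a complement of N (π(D) = Q and D ∩ N = 1) and N ≠ 1, then
      -- S̄₁ is all-or-nothing: from p ∈ S̄₁ pick d over p; then ι h₀ d lies
      -- in S ∖ D, and multiplying by D reaches every other coset.
      complement-allOrNothing : (∀ q → ImageD q) → (∀ h → D (ι h) → h ≡ H.ε) →
                                ∀ {h₀} → h₀ ≢ H.ε → AllOrNothing Q S̄₁
      complement-allOrNothing full D∩N-trivial {h₀} h₀≢ε p p' p≢ε p'≢ε t =
        subst S̄₁ π-moved (S-outside _ moved∈S (λ e → p'≢ε (trans (sym π-moved) e)))
        where
        k k' : Elt G
        k = proj₁ (full p)
        k' = proj₁ (full p')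
        k∈D : D k
        k∈D = proj₁ (proj₂ (full p))
        k'∈D : D k'
        k'∈D = proj₁ (proj₂ (full p'))
        g : Elt G
        g = ι h₀ ∙ k
        πg : π g ≡ p
        πg = trans (π-absorbˡ k (ι h₀) (ι∈N h₀)) (proj₂ (proj₂ (full p)))
        g∉D : ¬ D g
        g∉D g∈D = h₀≢ε (D∩N-trivial h₀ (subst D ([y∙x]∙x⁻¹≡y k (ι h₀)) (D-∙ _ _ g∈D (D-⁻¹ k k∈D))))
        moved∈S : S (g ∙ (k ⁻¹ ∙ k'))
        moved∈S = absorbʳ g _ g∉D (D-∙ _ _ (D-⁻¹ k k∈D) k'∈D) (inj₁ (subst S̄₁ (sym πg) t))
        π-moved : π (g ∙ (k ⁻¹ ∙ k')) ≡ p'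
        π-moved = begin
          π (ι h₀ ∙ k ∙ (k ⁻¹ ∙ k'))     ≡⟨ cong π (assoc _ _ _) ⟩
          π (ι h₀ ∙ (k ∙ (k ⁻¹ ∙ k')))   ≡⟨ cong (λ w → π (ι h₀ ∙ w)) (x∙[x⁻¹∙y]≡y k k') ⟩
          π (ι h₀ ∙ k')                  ≡⟨ π-absorbˡ k' (ι h₀) (ι∈N h₀) ⟩
          π k'                           ≡⟨ proj₂ (proj₂ (full p')) ⟩
          p'                             ∎
          where open ≡-Reasoning

    -- Lemma: S ∖ N being a union of cosets of the proper subgroup N ≠ 1,
    -- Cay(G,S) is not a DRR.
    not-DRR : ∀ {h₀ g₀} → h₀ ≢ H.ε → ¬ N g₀ → ¬ IsDRR G S
    not-DRR {h₀} {g₀} h₀≢ε g₀∉N drr =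
      h₀≢ε (ι-injective (trans (absorbing-trivial N-absorbing drr (g₀ , g₀∉N) (ι h₀) (ι∈N h₀)) (sym ι.hom-ε)))
      where open Obstructions G using (absorbing-trivial)

    -- coordinates of g: its coset π g and its position in that coset
    -- relative to the chosen representative σ (π g)
    fibre-∈N : ∀ g → N (g ∙ σ (π g) ⁻¹)
    fibre-∈N g = begin
      π (g ∙ σ (π g) ⁻¹)            ≡⟨ π.hom-quotient g _ ⟩
      π g Q.∙ π (σ (π g)) Q.⁻¹      ≡⟨ cong (λ q → π g Q.∙ q Q.⁻¹) (πσ (π g)) ⟩
      π g Q.∙ π g Q.⁻¹              ≡⟨ Q.inverseʳ _ ⟩
      Q.ε                           ∎
      where open ≡-Reasoning

    fibre : Elt G → Elt H
    fibre g = lift _ (fibre-∈N g)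

    ι-fibre : ∀ g → ι (fibre g) ≡ g ∙ σ (π g) ⁻¹
    ι-fibre g = ι-lift _ (fibre-∈N g)

    fibre-quotient : ∀ u v → π u ≡ π v → ι (fibre v H.∙ fibre u H.⁻¹) ≡ v ∙ u ⁻¹
    fibre-quotient u v πu≡πv = begin
      ι (fibre v H.∙ fibre u H.⁻¹)                  ≡⟨ ι.hom-quotient _ _ ⟩
      ι (fibre v) ∙ ι (fibre u) ⁻¹                  ≡⟨ cong₂ (λ x y → x ∙ y ⁻¹) (ι-fibre v) (ι-fibre u) ⟩
      v ∙ σ (π v) ⁻¹ ∙ (u ∙ σ (π u) ⁻¹) ⁻¹          ≡⟨ cong (λ q → v ∙ σ q ⁻¹ ∙ (u ∙ σ (π u) ⁻¹) ⁻¹) (sym πu≡πv) ⟩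
      v ∙ σ (π u) ⁻¹ ∙ (u ∙ σ (π u) ⁻¹) ⁻¹          ≡⟨ [x∙z]∙[y∙z]⁻¹≡x∙y⁻¹ v u _ ⟩
      v ∙ u ⁻¹                                      ∎
      where open ≡-Reasoning

    module CG = CayleyKit G
    module CQ = CayleyKit Q
    module CH = CayleyKit H

    coordinates : ∀ q h → (π (ι h ∙ σ q) , fibre (ι h ∙ σ q)) ≡ (q , h)
    coordinates q h = cong₂ _,_ π-point (ι-injective (begin
      ι (fibre (ι h ∙ σ q))                       ≡⟨ ι-fibre _ ⟩
      ι h ∙ σ q ∙ σ (π (ι h ∙ σ q)) ⁻¹            ≡⟨ cong (λ q' → ι h ∙ σ q ∙ σ q' ⁻¹) π-point ⟩
      ι h ∙ σ q ∙ σ q ⁻¹                          ≡⟨ [y∙x]∙x⁻¹≡y (σ q) (ι h) ⟩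
      ι h                                         ∎))
      where
      open ≡-Reasoning
      π-point : π (ι h ∙ σ q) ≡ q
      π-point = trans (π-absorbˡ (σ q) (ι h) (ι∈N h)) (πσ q)

    edge-to-wreath : ∀ u v → E (Cay G S) u v → E (Wreath (Cay Q S̄₁) (Cay H S₂)) (π u , fibre u) (π v , fibre v)
    edge-to-wreath u v e with CG.edge⇒quotient S u v e
    ... | inj₁ t = inj₁ (CQ.quotient⇒edge S̄₁ (π u) (π v) (subst S̄₁ (π.hom-quotient v u) t))
    ... | inj₂ (h , ιh≡vu⁻¹ , s) =
      inj₂ (πu≡πv , CH.quotient⇒edge S₂ (fibre u) (fibre v)
                      (subst S₂ (ι-injective (trans ιh≡vu⁻¹ (sym (fibre-quotient u v πu≡πv)))) s))
      where
      πu≡πv : π u ≡ π v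
      πu≡πv = sym (Q.x∙y⁻¹≈ε⇒x≈y _ _ (trans (sym (π.hom-quotient v u)) (subst N ιh≡vu⁻¹ (ι∈N h))))

    edge-from-wreath : ∀ u v → E (Wreath (Cay Q S̄₁) (Cay H S₂)) (π u , fibre u) (π v , fibre v) → E (Cay G S) u v
    edge-from-wreath u v (inj₁ e) =
      CG.quotient⇒edge S u v (inj₁ (subst S̄₁ (sym (π.hom-quotient v u)) (CQ.edge⇒quotient S̄₁ (π u) (π v) e)))
    edge-from-wreath u v (inj₂ (πu≡πv , e)) =
      CG.quotient⇒edge S u v (inj₂ (_ , fibre-quotient u v πu≡πv , CH.edge⇒quotient S₂ (fibre u) (fibre v) e))

    wreath-iso : DigraphIso (Cay G S) (Wreath (Cay Q S̄₁) (Cay H S₂))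
    wreath-iso = record
      { fun = λ g → π g , fibre g
      ; invFun = λ { (q , h) → ι h ∙ σ q }
      ; leftInv = λ g → trans (cong (_∙ σ (π g)) (ι-fibre g)) ([y∙x⁻¹]∙x≡y _ g)
      ; rightInv = λ { (q , h) → coordinates q h }
      ; edge = λ u v → edge-to-wreath u v , edge-from-wreath u v }

    module Rigidity (loopless₁ : Loopless Q S̄₁) (drr₁ : IsDRR Q S̄₁) (drr₂ : IsDRR H S₂)
                    {h₀ : Elt H} (h₀≢ε : h₀ ≢ H.ε) {g₀ : Elt G} (g₀∉N : ¬ N g₀)
                    (centre-N≤centre-G : ∀ h → Central H h → Central G (ι h))
                    {a b z : ℕ} (size-a : HasSize (Derived Q) a) (ab≡|Q| : a * b ≡ order Q)
                    (size-z : HasSize (Central H) z) (coprime : Coprime b z) where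
      open Obstructions using (absorbing-trivial; transport-absorbing; allOrNothing-drr)
      open CayleyKit using (drr⇒trivialAutGS)

      module _ (φ : GroupAut G) (preserves : ∀ x → S x ⇔ S (GroupAut.fun φ x)) where
        open GroupAut φ

        φN-absorbing : Absorbing G S
        φN-absorbing = transport-absorbing G φ preserves N-absorbing
        open Absorbing φN-absorbing using (D-∙) renaming (D to K)

        φN⊆K : ∀ h → K (fun (ι h))
        φN⊆K h = subst N (sym (leftInv (ι h))) (ι∈N h)

        -- if π(K) = Q and N ⊆ K then K = G, so g₀ ∈ N
        N⊈K : (∀ q → ImageD φN-absorbing q) → ¬ (∀ h → K (ι h))
        N⊈K full N⊆K = g₀∉N (subst N (leftInv g₀) (everything-in-K (fun g₀)))
          where
          everything-in-K : ∀ x → K x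
          everything-in-K x with full (π x)
          ... | k , k∈K , πk≡πx = subst K (x∙[x⁻¹∙y]≡y k x)
                  (D-∙ _ _ k∈K (subst K (ι-lift _ n∈N) (N⊆K (lift _ n∈N))))
            where
            n∈N : N (k ⁻¹ ∙ x)
            n∈N = same-coset k x πk≡πx

        -- if K is a complement of N, S̄₁ is all-or-nothing, so |Q| = 2; as
        -- h ↦ π (φ (ι h)) embeds H into Q, also |H| = 2
        not-complement : (∀ q → ImageD φN-absorbing q) → ¬ (∀ h → K (ι h) → h ≡ H.ε)
        not-complement full K∩N-trivial = twoElements-not-coprime Q H two-Q two-H size-a ab≡|Q| size-z coprime
          where
          two-Q : TwoElements Q (π g₀)
          two-Q = g₀∉N , ε-or-πg₀
            where
            ε-or-πg₀ : ∀ q → q ≡ Q.ε ⊎ q ≡ π g₀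
            ε-or-πg₀ q with q ≟ Q.ε
            ... | yes q≡ε = inj₁ q≡ε
            ... | no q≢ε  = inj₂ (allOrNothing-drr Q S̄₁ drr₁
                                    (complement-allOrNothing φN-absorbing full K∩N-trivial h₀≢ε) q (π g₀) q≢ε g₀∉N)
          φ-faithful : ∀ {x} → fun x ≡ ε → x ≡ ε
          φ-faithful {x} e = trans (sym (leftInv x))
            (trans (cong invFun (trans e (sym (HomKit.hom-ε G G fun hom)))) (leftInv ε))
          faithful : ∀ h → π (fun (ι h)) ≡ Q.ε → h ≡ H.ε
          faithful h φιh∈N = ι-injective (trans (φ-faithful (begin
            fun (ι h)                  ≡⟨ sym (ι-lift _ φιh∈N) ⟩
            ι (lift _ φιh∈N)           ≡⟨ cong ι (K∩N-trivial _ (subst K (sym (ι-lift _ φιh∈N)) (φN⊆K h))) ⟩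
            ι H.ε                      ≡⟨ ι.hom-ε ⟩
            ε                          ∎)) (sym ι.hom-ε))
            where open ≡-Reasoning
          two-H : TwoElements H h₀
          two-H = twoElements-pullback H Q (λ h → π (fun (ι h)))
                    (λ x y → trans (cong (λ w → π (fun w)) (ι-hom x y)) (trans (cong π (hom _ _)) (π-hom _ _)))
                    faithful two-Q h₀≢ε

        -- If π(K) ≠ Q then π(K) = 1, as Cay(Q,S̄₁)
        -- is a DRR, i.e. K ⊆ N.  Otherwise N ⊈ K, so K ∩ N = 1 as Cay(H,S₂)
        -- is a DRR, and K is a complement of N: impossible.
        preserves-N : ∀ h → N (fun (ι h))
        preserves-N h with all? (Absorbing.D? (image-absorbing φN-absorbing))
        ... | no not-full = absorbing-trivial Q (image-absorbing φN-absorbing) drr₁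
                              (¬∀⟶∃¬ _ _ (Absorbing.D? (image-absorbing φN-absorbing)) not-full)
                              (π (fun (ι h))) (fun (ι h) , φN⊆K h , refl)
        ... | yes full with all? (λ h → N? (invFun (ι h)))
        ...   | yes N⊆K    = ⊥-elim (N⊈K full N⊆K)
        ...   | no some-out = ⊥-elim (not-complement full
                                (absorbing-trivial H (preimage-absorbing φN-absorbing loopless₁) drr₂
                                   (¬∀⟶∃¬ _ _ (λ h → N? (invFun (ι h))) some-out)))

      -- φ restricts to an automorphism of H preserving S₂ and induces one
      -- of Q preserving S̄₁; both are trivial as these Cayley digraphs are
      -- DRRs, so φ acts trivially on N and on G/N.
      module Fixed (φ : GroupAut G) (preserves : ∀ x → S x ⇔ S (GroupAut.fun φ x)) where
        open GroupAut φ
        preserves⁻¹ : ∀ x → S x ⇔ S (invFun x)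
        preserves⁻¹ x = (λ s → proj₂ (preserves (invFun x)) (subst S (sym (rightInv x)) s))
                      , (λ s → subst S (rightInv x) (proj₁ (preserves (invFun x)) s))
        N-preserved : ∀ h → N (fun (ι h))
        N-preserved = preserves-N φ preserves
        N-preserved⁻¹ : ∀ h → N (invFun (ι h))
        N-preserved⁻¹ = preserves-N (inverseAut φ) preserves⁻¹
        open Restriction φ N-preserved N-preserved⁻¹

        restrict-preserves : ∀ h → S₂ h ⇔ S₂ (GroupAut.fun restrict h)
        restrict-preserves h =
            (λ s → S-inside loopless₁ _ (subst S (sym (ι-restrict h)) (proj₁ (preserves (ι h)) (inj₂ (h , refl , s)))))
          , (λ s → S-inside loopless₁ h (proj₂ (preserves (ι h)) (subst S (ι-restrict h) (inj₂ (_ , refl , s)))))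

        fixes-N : ∀ h → fun (ι h) ≡ ι h
        fixes-N h = trans (sym (ι-restrict h)) (cong ι (drr⇒trivialAutGS H S₂ drr₂ restrict restrict-preserves h))

        N-invariant : ∀ x → N (fun x) → N x
        N-invariant x φx∈N = subst N (trans (cong invFun (ι-lift _ φx∈N)) (leftInv x)) (N-preserved⁻¹ _)
        N-invariant⁻¹ : ∀ x → N x → N (fun x)
        N-invariant⁻¹ x x∈N = subst N (cong fun (ι-lift _ x∈N)) (N-preserved _)

        induce-preserves : ∀ q → S̄₁ q ⇔ S̄₁ (GroupAut.fun induce q)
        induce-preserves q =
            (λ t → S-outside _ (proj₁ (preserves (σ q)) (σ∈S t))
                     (λ φσq∈N → loopless₁ (subst S̄₁ (trans (sym (πσ q)) (N-invariant _ φσq∈N)) t)))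
          , (λ t → subst S̄₁ (πσ q) (S-outside _ (proj₂ (preserves (σ q)) (inj₁ t))
                     (λ σq∈N → loopless₁ (subst S̄₁ (N-invariant⁻¹ _ σq∈N) t))))
          where
          σ∈S : S̄₁ q → S (σ q)
          σ∈S t = inj₁ (subst S̄₁ (sym (πσ q)) t)

        fixes-Q : ∀ g → π (fun g) ≡ π g
        fixes-Q g = trans (π-induce g) (drr⇒trivialAutGS Q S̄₁ drr₁ induce induce-preserves (π g))

      trivialAutGS : TrivialAutGS G S
      trivialAutGS φ preserves =
        CentralAutomorphism.central-automorphism-trivial centre-N≤centre-G size-a ab≡|Q| size-z coprime
          φ (Fixed.fixes-N φ preserves) (Fixed.fixes-Q φ preserves)

  module Witnesses {h₀ : Elt H} (h₀≢ε : h₀ ≢ H.ε) {g₀ : Elt G} (g₀∉N : ¬ N g₀)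
                   (centre-N≤centre-G : ∀ h → Central H h → Central G (ι h))
                   {a b z : ℕ} (size-a : HasSize (Derived Q) a) (ab≡|Q| : a * b ≡ order Q)
                   (size-z : HasSize (Central H) z) (coprime : Coprime b z) where
    open WithoutIdentity using (T°; T°-loopless; T°-inverseClosed; drr-T°)

    witness-DRR : ∀ S̄₁ S₂ → Loopless Q S̄₁ → IsDRR Q S̄₁ → IsDRR H S₂ →
                  WitnessNotDRRDetecting G (LiftUnion G H Q ι π S̄₁ S₂)
    witness-DRR S̄₁ S₂ loopless₁ drr₁ drr₂ = trivialAutGS , not-DRR h₀≢ε g₀∉N
      where
      open Lifted S̄₁ S₂
      open Rigidity loopless₁ drr₁ drr₂ h₀≢ε g₀∉N centre-N≤centre-G size-a ab≡|Q| size-z coprime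

    witness-GRR : ∀ S̄₁ S₂ → Loopless Q S̄₁ → IsGRR Q S̄₁ → IsGRR H S₂ →
                  WitnessNotGRRDetecting G (LiftUnion G H Q ι π S̄₁ S₂)
    witness-GRR S̄₁ S₂ loopless₁ (closed₁ , drr₁) (closed₂ , drr₂) =
      let (trivial , not-drr) = witness-DRR S̄₁ S₂ loopless₁ drr₁ drr₂
      in Lifted.S-inverseClosed S̄₁ S₂ closed₁ closed₂ , trivial , λ grr → not-drr (proj₂ grr)

    -- a DRR (GRR) stays one after removing ε from its connection set
    not-DRR-detecting : AdmitsDRR H → AdmitsDRR Q → ¬ DRRDetecting G
    not-DRR-detecting (S₂ , drr₂) (S₁ , drr₁) detecting =
      let (trivial , not-drr) = witness-DRR (T° Q S₁) (T° H S₂) (T°-loopless Q S₁) (drr-T° Q S₁ drr₁) (drr-T° H S₂ drr₂)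
      in not-drr (detecting _ trivial)

    not-GRR-detecting : AdmitsGRR H → AdmitsGRR Q → ¬ GRRDetecting G
    not-GRR-detecting (S₂ , closed₂ , drr₂) (S₁ , closed₁ , drr₁) detecting =
      let (closed , trivial , not-grr) = witness-GRR (T° Q S₁) (T° H S₂) (T°-loopless Q S₁)
            (T°-inverseClosed Q S₁ closed₁ , drr-T° Q S₁ drr₁) (T°-inverseClosed H S₂ closed₂ , drr-T° H S₂ drr₂)
      in not-grr (detecting _ closed trivial)

corollary4p11 :
    (G H Q : FinGroup) (ι : Elt H → Elt G) (π : Elt G → Elt Q) →
    IsHom H G ι → Injective _≡_ _≡_ ι →
    IsHom G Q π → (∀ q → ∃ λ g → π g ≡ q) →
    (∀ g → (π g ≡ FinGroup.ε Q → ∃ λ h → ι h ≡ g) × ((∃ λ h → ι h ≡ g) → π g ≡ FinGroup.ε Q)) →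
    (∃ λ h → h ≢ FinGroup.ε H) →
    (∃ λ g → ¬ (∃ λ h → ι h ≡ g)) →
    (∀ h → Central H h → Central G (ι h)) →
    (Σ ℕ λ a → Σ ℕ λ b → Σ ℕ λ z →
       HasSize (Derived Q) a × a * b ≡ order Q × HasSize (Central H) z × Coprime b z) →
    ((AdmitsDRR H → AdmitsDRR Q → ¬ DRRDetecting G) ×
     (AdmitsGRR H → AdmitsGRR Q → ¬ GRRDetecting G) ×
     (∀ (S̄₁ : Subset Q) (S₂ : Subset H) → Loopless Q S̄₁ → Loopless H S₂ →
        IsDRR Q S̄₁ → IsDRR H S₂ →
        WitnessNotDRRDetecting G (LiftUnion G H Q ι π S̄₁ S₂) ×
        DigraphIso (Cay G (LiftUnion G H Q ι π S̄₁ S₂)) (Wreath (Cay Q S̄₁) (Cay H S₂))) ×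
     (∀ (S̄₁ : Subset Q) (S₂ : Subset H) → Loopless Q S̄₁ → Loopless H S₂ →
        IsGRR Q S̄₁ → IsGRR H S₂ →
        WitnessNotGRRDetecting G (LiftUnion G H Q ι π S̄₁ S₂) ×
        DigraphIso (Cay G (LiftUnion G H Q ι π S̄₁ S₂)) (Wreath (Cay Q S̄₁) (Cay H S₂))))
corollary4p11 G H Q ι π ι-hom ι-injective π-hom π-surjective kernel (h₀ , h₀≢ε) (g₀ , g₀∉ιH)
              centre-N≤centre-G (a , b , z , size-a , ab≡|Q| , size-z , coprime) =
    not-DRR-detecting
  , not-GRR-detecting
  , (λ S̄₁ S₂ loopless₁ _ drr₁ drr₂ → witness-DRR S̄₁ S₂ loopless₁ drr₁ drr₂ , Lifted.wreath-iso S̄₁ S₂)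
  , (λ S̄₁ S₂ loopless₁ _ grr₁ grr₂ → witness-GRR S̄₁ S₂ loopless₁ grr₁ grr₂ , Lifted.wreath-iso S̄₁ S₂)
  where
  open Extension G H Q ι π ι-hom ι-injective π-hom π-surjective kernel
  g₀∉N : ¬ N g₀
  g₀∉N g₀∈N = g₀∉ιH (proj₁ (kernel g₀) g₀∈N)
  open Witnesses h₀≢ε g₀∉N centre-N≤centre-G size-a ab≡|Q| size-z coprime
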